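{- For every integer $n\ge0$, \[ \sigma_3^{*}(n)=2n\sigma^{*}(n)-4\sum_{j=0}^{n}\sigma^{*}(j)\sigma^{*}(n-j). \]
   Context: For $n\ge1$ and $s\ge1$, $\sigma^{*}_{s}(n)=-\sum_{d\mid n}(-1)^{d}d^{s}$, and $\sigma^{*}(n)=\sigma^{*}_1(n)$. By convention $\sigma^{*}(0)=\frac18$ and $\sigma^{*}_3(0)=-\frac1{16}$. -}

module Defs where

open import Data.Nat as ℕ using (ℕ; zero; suc)
open import Data.Nat.Divisibility using (_∣?_)
open import Data.Integer as ℤ using (ℤ; +_)
open import Data.Rational as ℚ using (ℚ; _/_)
open import Data.List using (List; filter; map; sum; upTo)
open import Relation.Nullary.Decidable using (⌊_⌋)

sign : ℕ → ℤ
sign zero = ℤ.+ 1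
sign (suc d) = ℤ.- sign d

divisors : ℕ → List ℕ
divisors n = filter (λ d → d ∣? n) (map suc (upTo n))

-- σ*_s(n) = - Σ_{d ∣ n} (-1)^d d^s   (integer-valued, meaningful for n ≥ 1)
σ*ℤ : ℕ → ℕ → ℤ
σ*ℤ s n = ℤ.- sum' (map (λ d → sign d ℤ.* (+ (d ℕ.^ s))) (divisors n))
  where
  sum' : List ℤ → ℤ
  sum' = Data.List.foldr ℤ._+_ (+ 0)

σ* : ℕ → ℚ
σ* zero = (+ 1) / 8
σ* n@(suc _) = ℚ._/_ (σ*ℤ 1 n) 1

σ*₃ : ℕ → ℚ
σ*₃ zero = ℚ.- ((+ 1) / 16)
σ*₃ n@(suc _) = ℚ._/_ (σ*ℤ 3 n) 1

Σ[0…_] : ℕ → (ℕ → ℚ) → ℚ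
Σ[0… zero ] f = f 0
Σ[0… suc n ] f = Σ[0… n ] f ℚ.+ f (suc n)

-- Write σ*_s(n) = Σ_{de=n} ε(d) d^s with ε(d) = (-1)^(d+1).  Then 4 Σ_{0<j<n} σ*(j) σ*(n-j) is the
-- sum of 4 ε(a)a ε(b)b over the solutions of ax + by = n in positive integers, which Liouville's method
-- evaluates.  If g(a+b, b) = g(a, a+b) = G(a, b), the bijection (a, b, x, y) ↦ (a-b, b, x, x+y) from the
-- solutions with a > b onto those with x < y turns Σ_{a>b} g(a, b) into Σ_{x<y} G(a, b), and symmetrically
-- Σ_{a<b} g = Σ_{x>y} G.  So Σ (g - G) reduces to the diagonals: the solutions with a = b give
-- Σ_{de=n} g(d, d)(e-1), those with x = y give Σ_{de=n} Σ_{0<a<d} G(a, d-a).  For the parity-dependent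
-- quadratic forms below, g - G = 4 ε(a)a ε(b)b, g(d, d) = 2 ε(d)d² and Σ_{0<a<d} G(a, d-a) = ε(d)d(d-1)²,
-- whence 4 Σ_{0<j<n} σ*(j) σ*(n-j) = (2n-1) σ*(n) - σ*_3(n); the terms j = 0 and j = n add σ*(n)/8 each.

module Submission where

open import Defs
open import Data.Nat using (ℕ; _∸_)
open import Data.Integer using (+_)
open import Relation.Binary.PropositionalEquality using (_≡_)

module IntegerIdentity where
  open import Data.Bool using (Bool; true; false)
  open import Data.Nat as ℕ using (zero; suc; _≤_; _<_; z≤n; s≤s)
  import Data.Nat.Properties as ℕ
  open import Data.Integer using (ℤ; 0ℤ; 1ℤ; -1ℤ; _+_; _*_; -_; _-_; _^_)
  import Data.Integer.Properties as ℤ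
  open import Data.Integer.Tactic.RingSolver using (solve-∀)
  open import Data.Nat.Tactic.RingSolver using () renaming (solve-∀ to ℕ-solve-∀)
  open import Algebra.Properties.CommutativeSemigroup ℤ.+-commutativeSemigroup using (interchange)
  open import Algebra.Properties.CommutativeSemigroup ℤ.*-commutativeSemigroup using (x∙yz≈y∙xz)
  open import Algebra.Properties.Ring ℤ.+-*-ring using (x[y-z]≈xy-xz)
  open import Data.List using (List; []; _∷_; foldr; map; filter; applyUpTo; upTo)
  import Data.List.Properties as List
  open import Data.Nat.Divisibility using (_∣?_; divides)
  open import Data.Sum using (_⊎_; inj₁; inj₂)
  open import Relation.Unary using (Pred; Decidable)
  open import Function using (_∘_)
  open import Data.Empty using (⊥-elim)
  open import Relation.Binary.PropositionalEquality
    using (_≢_; _≗_; refl; sym; trans; cong; cong₂; subst; module ≡-Reasoning)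
  open import Relation.Nullary.Decidable using (Dec; yes; no; does; dec-true; dec-false)

  m≤m*n⁺ : ∀ m {n} → 1 ≤ n → m ≤ m ℕ.* n
  m≤m*n⁺ m 1≤n = ℕ.m≤m*n m _ {{ℕ.>-nonZero 1≤n}}

  m≤n*m⁺ : ∀ m {n} → 1 ≤ n → m ≤ n ℕ.* m
  m≤n*m⁺ m 1≤n = ℕ.m≤n*m m _ {{ℕ.>-nonZero 1≤n}}

  pos-∸ : ∀ {a m} → a ≤ m → + (m ∸ a) ≡ + m - + a
  pos-∸ {a} {m} a≤m = trans (sym (ℤ.⊖-≥ a≤m)) (sym (ℤ.m-n≡m⊖n m a))

  pos-^ : ∀ m k → + (m ℕ.^ k) ≡ (+ m) ^ k
  pos-^ m zero    = refl
  pos-^ m (suc k) = trans (ℤ.pos-* m (m ℕ.^ k)) (cong (_*_ (+ m)) (pos-^ m k))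

  𝟙 : Bool → ℤ
  𝟙 true  = 1ℤ
  𝟙 false = 0ℤ

  -- Going through does makes [ suc m ≡ suc n ] reduce to [ m ≡ n ], and likewise for [_<_];
  -- the inductions on brackets below rely on this.
  [_≡_] : ℕ → ℕ → ℤ
  [ m ≡ n ] = 𝟙 (does (m ℕ.≟ n))

  [_<_] : ℕ → ℕ → ℤ
  [ m < n ] = 𝟙 (does (m ℕ.<? n))

  [≡]-yes : ∀ {m n} → m ≡ n → [ m ≡ n ] ≡ 1ℤ
  [≡]-yes {m} {n} p = cong 𝟙 (dec-true (m ℕ.≟ n) p)

  [≡]-no : ∀ {m n} → m ≢ n → [ m ≡ n ] ≡ 0ℤ
  [≡]-no {m} {n} p = cong 𝟙 (dec-false (m ℕ.≟ n) p)

  [≡]-above : ∀ {m n} → n < m → [ m ≡ n ] ≡ 0ℤ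
  [≡]-above n<m = [≡]-no λ m≡n → ℕ.<-irrefl (sym m≡n) n<m

  [<]-yes : ∀ {m n} → m < n → [ m < n ] ≡ 1ℤ
  [<]-yes {m} {n} p = cong 𝟙 (dec-true (m ℕ.<? n) p)

  [<]-no : ∀ {m n} → n ≤ m → [ m < n ] ≡ 0ℤ
  [<]-no {m} {n} p = cong 𝟙 (dec-false (m ℕ.<? n) (ℕ.≤⇒≯ p))

  [≡]-sym : ∀ m n → [ m ≡ n ] ≡ [ n ≡ m ]
  [≡]-sym zero    zero    = refl
  [≡]-sym zero    (suc n) = refl
  [≡]-sym (suc m) zero    = refl
  [≡]-sym (suc m) (suc n) = [≡]-sym m n

  [≡]-⇔ : ∀ {m n m′ n′} → (m ≡ n → m′ ≡ n′) → (m′ ≡ n′ → m ≡ n) → [ m ≡ n ] ≡ [ m′ ≡ n′ ]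
  [≡]-⇔ {m} {n} {m′} {n′} to from with m ℕ.≟ n
  ... | yes m≡n = trans ([≡]-yes m≡n) (sym ([≡]-yes (to m≡n)))
  ... | no m≢n  = trans ([≡]-no m≢n) (sym ([≡]-no (λ m′≡n′ → m≢n (from m′≡n′))))

  [≡∸] : ∀ {c n} v → c ≤ n → [ v ≡ n ∸ c ] ≡ [ c ℕ.+ v ≡ n ]
  [≡∸] v z≤n       = refl
  [≡∸] v (s≤s c≤n) = [≡∸] v c≤n

  [<]-trichotomy : ∀ m n → [ m < n ] + [ m ≡ n ] + [ n < m ] ≡ 1ℤ
  [<]-trichotomy zero    zero    = refl
  [<]-trichotomy zero    (suc n) = refl
  [<]-trichotomy (suc m) zero    = refl
  [<]-trichotomy (suc m) (suc n) = [<]-trichotomy m n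

  [≡]*-cong : ∀ m n x y → (m ≡ n → x ≡ y) → [ m ≡ n ] * x ≡ [ m ≡ n ] * y
  [≡]*-cong m n x y = go (m ℕ.≟ n)
    where
    go : (d : Dec (m ≡ n)) → (m ≡ n → x ≡ y) → 𝟙 (does d) * x ≡ 𝟙 (does d) * y
    go (yes p) eq = cong (1ℤ *_) (eq p)
    go (no _)  _  = refl

  ∑[1…_] : ℕ → (ℕ → ℤ) → ℤ
  ∑[1… zero  ] f = 0ℤ
  ∑[1… suc n ] f = f 1 + ∑[1… n ] (f ∘ suc)

  ∑-cong : ∀ n {f g : ℕ → ℤ} → (∀ i → 1 ≤ i → i ≤ n → f i ≡ g i) → ∑[1… n ] f ≡ ∑[1… n ] g
  ∑-cong zero    eq = refl
  ∑-cong (suc n) eq =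
    cong₂ _+_ (eq 1 (s≤s z≤n) (s≤s z≤n)) (∑-cong n λ i 1≤i i≤n → eq (suc i) (s≤s z≤n) (s≤s i≤n))

  ∑-cong-≗ : ∀ n {f g : ℕ → ℤ} → f ≗ g → ∑[1… n ] f ≡ ∑[1… n ] g
  ∑-cong-≗ n eq = ∑-cong n λ i _ _ → eq i

  ∑-zero : ∀ n {f : ℕ → ℤ} → (∀ i → 1 ≤ i → i ≤ n → f i ≡ 0ℤ) → ∑[1… n ] f ≡ 0ℤ
  ∑-zero zero    eq = refl
  ∑-zero (suc n) eq =
    cong₂ _+_ (eq 1 (s≤s z≤n) (s≤s z≤n)) (∑-zero n λ i 1≤i i≤n → eq (suc i) (s≤s z≤n) (s≤s i≤n))

  ∑-distrib-+ : ∀ n (f g : ℕ → ℤ) → ∑[1… n ] (λ i → f i + g i) ≡ ∑[1… n ] f + ∑[1… n ] g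
  ∑-distrib-+ zero    f g = refl
  ∑-distrib-+ (suc n) f g = trans (cong (_+_ (f 1 + g 1)) (∑-distrib-+ n (f ∘ suc) (g ∘ suc)))
                                  (interchange (f 1) (g 1) _ _)

  ∑-distribˡ-* : ∀ n c (f : ℕ → ℤ) → ∑[1… n ] (λ i → c * f i) ≡ c * ∑[1… n ] f
  ∑-distribˡ-* zero    c f = sym (ℤ.*-zeroʳ c)
  ∑-distribˡ-* (suc n) c f = trans (cong (_+_ (c * f 1)) (∑-distribˡ-* n c (f ∘ suc)))
                                   (sym (ℤ.*-distribˡ-+ c (f 1) _))

  ∑-distribʳ-* : ∀ n c (f : ℕ → ℤ) → ∑[1… n ] (λ i → f i * c) ≡ ∑[1… n ] f * c
  ∑-distribʳ-* n c f = begin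
    ∑[1… n ] (λ i → f i * c)  ≡⟨ ∑-cong-≗ n (λ i → ℤ.*-comm (f i) c) ⟩
    ∑[1… n ] (λ i → c * f i)  ≡⟨ ∑-distribˡ-* n c f ⟩
    c * ∑[1… n ] f            ≡⟨ ℤ.*-comm c _ ⟩
    ∑[1… n ] f * c            ∎
    where open ≡-Reasoning

  ∑-neg : ∀ n (f : ℕ → ℤ) → ∑[1… n ] (λ i → - f i) ≡ - ∑[1… n ] f
  ∑-neg zero    f = refl
  ∑-neg (suc n) f = trans (cong (_+_ (- f 1)) (∑-neg n (f ∘ suc))) (sym (ℤ.neg-distrib-+ (f 1) _))

  ∑-distrib-- : ∀ n (f g : ℕ → ℤ) → ∑[1… n ] (λ i → f i - g i) ≡ ∑[1… n ] f - ∑[1… n ] g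
  ∑-distrib-- n f g = trans (∑-distrib-+ n f (-_ ∘ g)) (cong (_+_ (∑[1… n ] f)) (∑-neg n g))

  ∑-*-∑ : ∀ m n (f g : ℕ → ℤ) → ∑[1… m ] f * ∑[1… n ] g ≡ ∑[1… m ] (λ i → ∑[1… n ] λ j → f i * g j)
  ∑-*-∑ m n f g = trans (sym (∑-distribʳ-* m (∑[1… n ] g) f))
                        (∑-cong-≗ m λ i → sym (∑-distribˡ-* n (f i) g))

  ∑-comm : ∀ m n (f : ℕ → ℕ → ℤ) →
           ∑[1… m ] (λ i → ∑[1… n ] (f i)) ≡ ∑[1… n ] (λ j → ∑[1… m ] (λ i → f i j))
  ∑-comm zero    n f = sym (∑-zero n λ _ _ _ → refl)
  ∑-comm (suc m) n f = trans (cong (_+_ (∑[1… n ] (f 1))) (∑-comm m n (f ∘ suc)))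
                             (sym (∑-distrib-+ n (f 1) _))

  ∑-split : ∀ k m (f : ℕ → ℤ) → ∑[1… k ℕ.+ m ] f ≡ ∑[1… k ] f + ∑[1… m ] (λ i → f (k ℕ.+ i))
  ∑-split zero    m f = sym (ℤ.+-identityˡ _)
  ∑-split (suc k) m f = trans (cong (_+_ (f 1)) (∑-split k m (f ∘ suc))) (sym (ℤ.+-assoc (f 1) _ _))

  ∑-last : ∀ n (f : ℕ → ℤ) → ∑[1… suc n ] f ≡ ∑[1… n ] f + f (suc n)
  ∑-last n f = begin
    ∑[1… suc n ] f                           ≡⟨ cong (λ k → ∑[1… k ] f) (ℕ.+-comm 1 n) ⟩
    ∑[1… n ℕ.+ 1 ] f                         ≡⟨ ∑-split n 1 f ⟩
    ∑[1… n ] f + (f (n ℕ.+ 1) + 0ℤ)          ≡⟨ cong (_+_ (∑[1… n ] f)) (ℤ.+-identityʳ _) ⟩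
    ∑[1… n ] f + f (n ℕ.+ 1)                 ≡⟨ cong (λ k → ∑[1… n ] f + f k) (ℕ.+-comm n 1) ⟩
    ∑[1… n ] f + f (suc n)                   ∎
    where open ≡-Reasoning

  ∑-truncate : ∀ {m n} {f : ℕ → ℤ} → m ≤ n → (∀ i → m < i → f i ≡ 0ℤ) → ∑[1… n ] f ≡ ∑[1… m ] f
  ∑-truncate {m} {n} {f} m≤n vanish = begin
    ∑[1… n ] f
      ≡⟨ cong (λ k → ∑[1… k ] f) (ℕ.m+[n∸m]≡n m≤n) ⟨
    ∑[1… m ℕ.+ (n ∸ m) ] f
      ≡⟨ ∑-split m (n ∸ m) f ⟩
    ∑[1… m ] f + ∑[1… n ∸ m ] (λ i → f (m ℕ.+ i))
      ≡⟨ cong (_+_ (∑[1… m ] f)) (∑-zero (n ∸ m) λ i 1≤i _ → vanish (m ℕ.+ i) (ℕ.m<m+n m 1≤i)) ⟩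
    ∑[1… m ] f + 0ℤ
      ≡⟨ ℤ.+-identityʳ _ ⟩
    ∑[1… m ] f ∎
    where open ≡-Reasoning

  ∑-const : ∀ n c → ∑[1… n ] (λ _ → c) ≡ + n * c
  ∑-const zero    c = sym (ℤ.*-zeroˡ c)
  ∑-const (suc n) c = trans (cong (_+_ c) (∑-const n c)) (sym (ℤ.suc-* (+ n) c))

  ∑-select : ∀ {n c} (f : ℕ → ℤ) → 1 ≤ c → c ≤ n → ∑[1… n ] (λ i → [ i ≡ c ] * f i) ≡ f c
  ∑-select {suc n} {suc zero} f _ _ = begin
    1ℤ * f 1 + ∑[1… n ] (λ i → [ suc i ≡ 1 ] * f (suc i))
      ≡⟨ cong₂ _+_ (ℤ.*-identityˡ (f 1)) (∑-zero n λ { (suc i) _ _ → refl }) ⟩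
    f 1 + 0ℤ
      ≡⟨ ℤ.+-identityʳ (f 1) ⟩
    f 1 ∎
    where open ≡-Reasoning
  ∑-select {suc n} {suc (suc c)} f _ (s≤s c<n) =
    trans (cong (_+ rest) (ℤ.*-zeroˡ (f 1))) (trans (ℤ.+-identityˡ rest) (∑-select (f ∘ suc) (s≤s z≤n) c<n))
    where rest = ∑[1… n ] (λ i → [ i ≡ suc c ] * f (suc i))

  ∑-select-split : ∀ n {p q} (α β : ℤ) → 1 ≤ p → 1 ≤ q →
    ∑[1… n ] (λ j → [ p ≡ j ] * α * ([ q ≡ suc n ∸ j ] * β)) ≡ [ p ℕ.+ q ≡ suc n ] * (α * β)
  ∑-select-split n {p} {q} α β 1≤p 1≤q with p ℕ.≤? n
  ... | yes p≤n = begin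
    ∑[1… n ] (λ j → [ p ≡ j ] * α * ([ q ≡ suc n ∸ j ] * β))
      ≡⟨ ∑-cong-≗ n (λ j → trans (regroup [ p ≡ j ] α [ q ≡ suc n ∸ j ] β) (cong (_* _) ([≡]-sym p j))) ⟩
    ∑[1… n ] (λ j → [ j ≡ p ] * ([ q ≡ suc n ∸ j ] * (α * β)))
      ≡⟨ ∑-select (λ j → [ q ≡ suc n ∸ j ] * (α * β)) 1≤p p≤n ⟩
    [ q ≡ suc n ∸ p ] * (α * β)
      ≡⟨ cong (_* (α * β)) ([≡∸] q (ℕ.m≤n⇒m≤1+n p≤n)) ⟩
    [ p ℕ.+ q ≡ suc n ] * (α * β) ∎
    where
    open ≡-Reasoning
    regroup : ∀ i α k β → i * α * (k * β) ≡ i * (k * (α * β))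
    regroup = solve-∀
  ... | no p≰n = trans (∑-zero n λ j _ j≤n → let X = [ q ≡ suc n ∸ j ] * β in
                         trans (cong (λ i → i * α * X) ([≡]-above (ℕ.≤-<-trans j≤n n<p)))
                               (trans (cong (_* X) (ℤ.*-zeroˡ α)) (ℤ.*-zeroˡ X)))
                       (sym (trans (cong (_* (α * β)) ([≡]-above N<p+q)) (ℤ.*-zeroˡ (α * β))))
    where
    n<p : n < p
    n<p = ℕ.≰⇒> p≰n
    N<p+q : suc n < p ℕ.+ q
    N<p+q = ℕ.≤-trans (s≤s n<p) (ℕ.m<m+n p 1≤q)

  ∑-shift : ∀ n k (h : ℕ → ℤ) → (∀ i → n < i → h i ≡ 0ℤ) →
            ∑[1… n ] (λ i → h (k ℕ.+ i)) ≡ ∑[1… n ] (λ i → [ k < i ] * h i)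
  ∑-shift n k h vanish = sym (begin
    ∑[1… n ] g
      ≡⟨ ∑-truncate (ℕ.m≤n+m n k) (λ i n<i → trans (cong (_*_ [ k < i ]) (vanish i n<i)) (ℤ.*-zeroʳ [ k < i ])) ⟨
    ∑[1… k ℕ.+ n ] g
      ≡⟨ ∑-split k n g ⟩
    ∑[1… k ] g + ∑[1… n ] (λ i → g (k ℕ.+ i))
      ≡⟨ cong₂ _+_ (∑-zero k λ i _ i≤k → trans (cong (_* h i) ([<]-no i≤k)) (ℤ.*-zeroˡ (h i)))
                   (∑-cong n λ i 1≤i _ → trans (cong (_* h (k ℕ.+ i)) ([<]-yes (ℕ.m<m+n k 1≤i))) (ℤ.*-identityˡ _)) ⟩
    0ℤ + ∑[1… n ] (λ i → h (k ℕ.+ i))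
      ≡⟨ ℤ.+-identityˡ _ ⟩
    ∑[1… n ] (λ i → h (k ℕ.+ i)) ∎)
    where
    open ≡-Reasoning
    g : ℕ → ℤ
    g i = [ k < i ] * h i

  ∑-below : ∀ n t (f : ℕ → ℤ) → t ≤ n → ∑[1… n ] (λ i → [ i < suc t ] * f i) ≡ ∑[1… t ] f
  ∑-below n t f t≤n = begin
    ∑[1… n ] (λ i → [ i < suc t ] * f i)
      ≡⟨ ∑-truncate t≤n (λ i t<i → trans (cong (_* f i) ([<]-no t<i)) (ℤ.*-zeroˡ (f i))) ⟩
    ∑[1… t ] (λ i → [ i < suc t ] * f i)
      ≡⟨ ∑-cong t (λ i _ i≤t → trans (cong (_* f i) ([<]-yes (s≤s i≤t))) (ℤ.*-identityˡ (f i))) ⟩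
    ∑[1… t ] f ∎
    where open ≡-Reasoning

  ∑-gauss : ∀ s → + 2 * ∑[1… s ] (λ t → + t) ≡ + s * (+ s + 1ℤ)
  ∑-gauss zero    = refl
  ∑-gauss (suc s) = begin
    + 2 * ∑[1… suc s ] (λ t → + t)               ≡⟨ cong (_*_ (+ 2)) (∑-last s (λ t → + t)) ⟩
    + 2 * (∑[1… s ] (λ t → + t) + + suc s)        ≡⟨ ℤ.*-distribˡ-+ (+ 2) (∑[1… s ] (λ t → + t)) (+ suc s) ⟩
    + 2 * ∑[1… s ] (λ t → + t) + + 2 * + suc s    ≡⟨ cong (_+ + 2 * + suc s) (∑-gauss s) ⟩
    + s * (+ s + 1ℤ) + + 2 * (1ℤ + + s)           ≡⟨ identity (+ s) ⟩
    + suc s * (+ suc s + 1ℤ)                      ∎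
    where
    open ≡-Reasoning
    identity : ∀ S → S * (S + 1ℤ) + + 2 * (1ℤ + S) ≡ (1ℤ + S) * ((1ℤ + S) + 1ℤ)
    identity = solve-∀

  ∑-affine : ∀ s c d → ∑[1… s ] (λ t → c + d * (+ 2 * + t)) ≡ + s * c + d * (+ s * (+ s + 1ℤ))
  ∑-affine s c d = begin
    ∑[1… s ] (λ t → c + d * (+ 2 * + t))              ≡⟨ ∑-distrib-+ s (λ _ → c) (λ t → d * (+ 2 * + t)) ⟩
    ∑[1… s ] (λ _ → c) + ∑[1… s ] (λ t → d * (+ 2 * + t))
      ≡⟨ cong₂ _+_ (∑-const s c) (trans (∑-distribˡ-* s d _) (cong (_*_ d) (∑-distribˡ-* s (+ 2) (λ t → + t)))) ⟩
    + s * c + d * (+ 2 * ∑[1… s ] (λ t → + t))       ≡⟨ cong (λ r → + s * c + d * r) (∑-gauss s) ⟩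
    + s * c + d * (+ s * (+ s + 1ℤ))                  ∎
    where open ≡-Reasoning

  -- Liouville's identity

  ∑[d*e≡_] : ℕ → (ℕ → ℕ → ℤ) → ℤ
  ∑[d*e≡ n ] f = ∑[1… n ] λ d → ∑[1… n ] λ e → [ d ℕ.* e ≡ n ] * f d e

  ∑[a*x+b*y≡_] : ℕ → (ℕ → ℕ → ℕ → ℕ → ℤ) → ℤ
  ∑[a*x+b*y≡ n ] F =
    ∑[1… n ] λ a → ∑[1… n ] λ b → ∑[1… n ] λ x → ∑[1… n ] λ y → [ a ℕ.* x ℕ.+ b ℕ.* y ≡ n ] * F a b x y

  module _ (n : ℕ) where

    ∑[d*e≡]-cong : ∀ {f f′ : ℕ → ℕ → ℤ} → (∀ d e → d ℕ.* e ≡ n → f d e ≡ f′ d e) →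
                   ∑[d*e≡ n ] f ≡ ∑[d*e≡ n ] f′
    ∑[d*e≡]-cong eq = ∑-cong-≗ n λ d → ∑-cong-≗ n λ e → [≡]*-cong (d ℕ.* e) n _ _ (eq d e)

    ∑[d*e≡]-distrib-- : ∀ (f f′ : ℕ → ℕ → ℤ) →
      ∑[d*e≡ n ] (λ d e → f d e - f′ d e) ≡ ∑[d*e≡ n ] f - ∑[d*e≡ n ] f′
    ∑[d*e≡]-distrib-- f f′ =
      trans (∑-cong-≗ n λ d → trans (∑-cong-≗ n λ e → x[y-z]≈xy-xz [ d ℕ.* e ≡ n ] (f d e) (f′ d e))
                                      (∑-distrib-- n _ _))
            (∑-distrib-- n _ _)

    ∑[d*e≡]-distribˡ-* : ∀ c (f : ℕ → ℕ → ℤ) → ∑[d*e≡ n ] (λ d e → c * f d e) ≡ c * ∑[d*e≡ n ] f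
    ∑[d*e≡]-distribˡ-* c f =
      trans (∑-cong-≗ n λ d → trans (∑-cong-≗ n λ e → x∙yz≈y∙xz [ d ℕ.* e ≡ n ] c (f d e)) (∑-distribˡ-* n c _))
            (∑-distribˡ-* n c _)

    ∑[d*e≡]-widen : ∀ {m} (f : ℕ → ℤ) → n ≤ m →
      ∑[1… m ] (λ d → ∑[1… m ] λ e → [ d ℕ.* e ≡ n ] * f d) ≡ ∑[d*e≡ n ] (λ d _ → f d)
    ∑[d*e≡]-widen {m} f n≤m = begin
      ∑[1… m ] (λ d → ∑[1… m ] λ e → [ d ℕ.* e ≡ n ] * f d)
        ≡⟨ ∑-cong m (λ d 1≤d _ → ∑-truncate n≤m λ e n<e →
             trans (cong (_* f d) ([≡]-above (ℕ.<-≤-trans n<e (m≤n*m⁺ e 1≤d)))) (ℤ.*-zeroˡ (f d))) ⟩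
      ∑[1… m ] (λ d → ∑[1… n ] λ e → [ d ℕ.* e ≡ n ] * f d)
        ≡⟨ ∑-truncate n≤m (λ d n<d → ∑-zero n λ e 1≤e _ →
             trans (cong (_* f d) ([≡]-above (ℕ.<-≤-trans n<d (m≤m*n⁺ d 1≤e)))) (ℤ.*-zeroˡ (f d))) ⟩
      ∑[d*e≡ n ] (λ d _ → f d) ∎
      where open ≡-Reasoning

    ∑[a*x+b*y≡]-cong : ∀ {F F′ : ℕ → ℕ → ℕ → ℕ → ℤ} → (∀ a b x y → F a b x y ≡ F′ a b x y) →
                       ∑[a*x+b*y≡ n ] F ≡ ∑[a*x+b*y≡ n ] F′
    ∑[a*x+b*y≡]-cong eq =
      ∑-cong-≗ n λ a → ∑-cong-≗ n λ b → ∑-cong-≗ n λ x → ∑-cong-≗ n λ y →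
      cong (_*_ [ a ℕ.* x ℕ.+ b ℕ.* y ≡ n ]) (eq a b x y)

    ∑[a*x+b*y≡]-distrib-+ : ∀ (F F′ : ℕ → ℕ → ℕ → ℕ → ℤ) →
      ∑[a*x+b*y≡ n ] (λ a b x y → F a b x y + F′ a b x y) ≡ ∑[a*x+b*y≡ n ] F + ∑[a*x+b*y≡ n ] F′
    ∑[a*x+b*y≡]-distrib-+ F F′ =
      trans (∑-cong-≗ n λ a → trans (∑-cong-≗ n λ b → trans (∑-cong-≗ n λ x → trans (∑-cong-≗ n λ y →
        ℤ.*-distribˡ-+ [ a ℕ.* x ℕ.+ b ℕ.* y ≡ n ] _ _)
        (∑-distrib-+ n _ _)) (∑-distrib-+ n _ _)) (∑-distrib-+ n _ _)) (∑-distrib-+ n _ _)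

    ∑[a*x+b*y≡]-distrib-- : ∀ (F F′ : ℕ → ℕ → ℕ → ℕ → ℤ) →
      ∑[a*x+b*y≡ n ] (λ a b x y → F a b x y - F′ a b x y) ≡ ∑[a*x+b*y≡ n ] F - ∑[a*x+b*y≡ n ] F′
    ∑[a*x+b*y≡]-distrib-- F F′ =
      trans (∑-cong-≗ n λ a → trans (∑-cong-≗ n λ b → trans (∑-cong-≗ n λ x → trans (∑-cong-≗ n λ y →
        x[y-z]≈xy-xz [ a ℕ.* x ℕ.+ b ℕ.* y ≡ n ] _ _)
        (∑-distrib-- n _ _)) (∑-distrib-- n _ _)) (∑-distrib-- n _ _)) (∑-distrib-- n _ _)

    ∑[a*x+b*y≡]-distribˡ-* : ∀ c (F : ℕ → ℕ → ℕ → ℕ → ℤ) →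
      ∑[a*x+b*y≡ n ] (λ a b x y → c * F a b x y) ≡ c * ∑[a*x+b*y≡ n ] F
    ∑[a*x+b*y≡]-distribˡ-* c F =
      trans (∑-cong-≗ n λ a → trans (∑-cong-≗ n λ b → trans (∑-cong-≗ n λ x → trans (∑-cong-≗ n λ y →
        x∙yz≈y∙xz [ a ℕ.* x ℕ.+ b ℕ.* y ≡ n ] c _)
        (∑-distribˡ-* n c _)) (∑-distribˡ-* n c _)) (∑-distribˡ-* n c _)) (∑-distribˡ-* n c _)

    ∑[a*x+b*y≡]-swap : ∀ (F : ℕ → ℕ → ℕ → ℕ → ℤ) →
      ∑[a*x+b*y≡ n ] (λ a b x y → F b a y x) ≡ ∑[a*x+b*y≡ n ] F
    ∑[a*x+b*y≡]-swap F =
      trans (∑-comm n n _) (∑-cong-≗ n λ b → ∑-cong-≗ n λ a →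
      trans (∑-comm n n _) (∑-cong-≗ n λ y → ∑-cong-≗ n λ x →
        cong (λ k → [ k ≡ n ] * F b a y x) (ℕ.+-comm (a ℕ.* x) (b ℕ.* y))))

    ∑[a*x+b*y≡]-trichotomy : ∀ (u v : ℕ → ℕ → ℕ → ℕ → ℕ) (F : ℕ → ℕ → ℕ → ℕ → ℤ) →
      ∑[a*x+b*y≡ n ] F ≡ ∑[a*x+b*y≡ n ] (λ a b x y → [ u a b x y < v a b x y ] * F a b x y)
                       + ∑[a*x+b*y≡ n ] (λ a b x y → [ u a b x y ≡ v a b x y ] * F a b x y)
                       + ∑[a*x+b*y≡ n ] (λ a b x y → [ v a b x y < u a b x y ] * F a b x y)
    ∑[a*x+b*y≡]-trichotomy u v F =
      trans (∑[a*x+b*y≡]-cong split)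
            (trans (∑[a*x+b*y≡]-distrib-+ (λ a b x y → P a b x y + Q a b x y) R)
                   (cong (_+ ∑[a*x+b*y≡ n ] R) (∑[a*x+b*y≡]-distrib-+ P Q)))
      where
      P Q R : ℕ → ℕ → ℕ → ℕ → ℤ
      P a b x y = [ u a b x y < v a b x y ] * F a b x y
      Q a b x y = [ u a b x y ≡ v a b x y ] * F a b x y
      R a b x y = [ v a b x y < u a b x y ] * F a b x y
      split : ∀ a b x y → F a b x y ≡ P a b x y + Q a b x y + R a b x y
      split a b x y = begin
        F a b x y                      ≡⟨ ℤ.*-identityˡ _ ⟨
        1ℤ * F a b x y                 ≡⟨ cong (_* F a b x y) ([<]-trichotomy (u a b x y) (v a b x y)) ⟨
        (p + q + r) * F a b x y        ≡⟨ distrib p q r (F a b x y) ⟩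
        p * F a b x y + q * F a b x y + r * F a b x y ∎
        where
        open ≡-Reasoning
        p = [ u a b x y < v a b x y ]
        q = [ u a b x y ≡ v a b x y ]
        r = [ v a b x y < u a b x y ]
        distrib : ∀ p q r f → (p + q + r) * f ≡ p * f + q * f + r * f
        distrib = solve-∀

    ∑[a*x+b*y≡]-shear-slice : ∀ (φ : ℕ → ℕ → ℤ) {b x} → 1 ≤ b → 1 ≤ x →
      ∑[1… n ] (λ a → ∑[1… n ] λ y → [ a ℕ.* x ℕ.+ b ℕ.* y ≡ n ] * ([ b < a ] * φ a b)) ≡
      ∑[1… n ] (λ a → ∑[1… n ] λ y → [ a ℕ.* x ℕ.+ b ℕ.* y ≡ n ] * ([ x < y ] * φ (a ℕ.+ b) b))
    ∑[a*x+b*y≡]-shear-slice φ {b} {x} 1≤b 1≤x = begin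
      ∑[1… n ] (λ a → ∑[1… n ] λ y → I a y * ([ b < a ] * φ a b))
        ≡⟨ ∑-cong-≗ n (λ a → trans (∑-cong-≗ n λ y → x∙yz≈y∙xz (I a y) [ b < a ] (φ a b))
                                   (∑-distribˡ-* n [ b < a ] (λ y → I a y * φ a b))) ⟩
      ∑[1… n ] (λ a → [ b < a ] * Ψ a)
        ≡⟨ ∑-shift n b Ψ (λ a n<a → ∑-zero n λ y _ _ →
             trans (cong (_* φ a b) (I-above-a n<a y)) (ℤ.*-zeroˡ (φ a b))) ⟨
      ∑[1… n ] (λ a → Ψ (b ℕ.+ a))
        ≡⟨ ∑-cong-≗ n (λ a → ∑-cong-≗ n λ y → cong (λ k → [ k ≡ n ] * φ (b ℕ.+ a) b) (shear-arith a b x y)) ⟩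
      ∑[1… n ] (λ a → ∑[1… n ] λ y → I a (x ℕ.+ y) * φ (b ℕ.+ a) b)
        ≡⟨ ∑-cong-≗ n (λ a → ∑-shift n x (λ y → I a y * φ (b ℕ.+ a) b) λ y n<y →
             trans (cong (_* φ (b ℕ.+ a) b) (I-above-y a n<y)) (ℤ.*-zeroˡ (φ (b ℕ.+ a) b))) ⟩
      ∑[1… n ] (λ a → ∑[1… n ] λ y → [ x < y ] * (I a y * φ (b ℕ.+ a) b))
        ≡⟨ ∑-cong-≗ n (λ a → ∑-cong-≗ n λ y → trans (x∙yz≈y∙xz [ x < y ] (I a y) (φ (b ℕ.+ a) b))
                                                   (cong (λ k → I a y * ([ x < y ] * φ k b)) (ℕ.+-comm b a))) ⟩
      ∑[1… n ] (λ a → ∑[1… n ] λ y → I a y * ([ x < y ] * φ (a ℕ.+ b) b)) ∎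
      where
      open ≡-Reasoning
      I : ℕ → ℕ → ℤ
      I a y = [ a ℕ.* x ℕ.+ b ℕ.* y ≡ n ]
      Ψ : ℕ → ℤ
      Ψ a = ∑[1… n ] λ y → I a y * φ a b
      shear-arith : ∀ a b x y → (b ℕ.+ a) ℕ.* x ℕ.+ b ℕ.* y ≡ a ℕ.* x ℕ.+ b ℕ.* (x ℕ.+ y)
      shear-arith = ℕ-solve-∀
      I-above-a : ∀ {a} → n < a → ∀ y → I a y ≡ 0ℤ
      I-above-a {a} n<a y = [≡]-above (ℕ.<-≤-trans n<a (ℕ.≤-trans (m≤m*n⁺ a 1≤x) (ℕ.m≤m+n (a ℕ.* x) (b ℕ.* y))))
      I-above-y : ∀ a {y} → n < y → I a y ≡ 0ℤ
      I-above-y a {y} n<y = [≡]-above (ℕ.<-≤-trans n<y (ℕ.≤-trans (m≤n*m⁺ y 1≤b) (ℕ.m≤n+m (b ℕ.* y) (a ℕ.* x))))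

    ∑[a*x+b*y≡]-shear : ∀ (φ : ℕ → ℕ → ℤ) →
      ∑[a*x+b*y≡ n ] (λ a b x y → [ b < a ] * φ a b) ≡ ∑[a*x+b*y≡ n ] (λ a b x y → [ x < y ] * φ (a ℕ.+ b) b)
    ∑[a*x+b*y≡]-shear φ = begin
      ∑[a*x+b*y≡ n ] (λ a b x y → [ b < a ] * φ a b)
        ≡⟨ reorder _ ⟩
      ∑[1… n ] (λ b → ∑[1… n ] λ x → ∑[1… n ] λ a → ∑[1… n ] λ y →
                 [ a ℕ.* x ℕ.+ b ℕ.* y ≡ n ] * ([ b < a ] * φ a b))
        ≡⟨ ∑-cong n (λ b 1≤b _ → ∑-cong n λ x 1≤x _ → ∑[a*x+b*y≡]-shear-slice φ 1≤b 1≤x) ⟩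
      ∑[1… n ] (λ b → ∑[1… n ] λ x → ∑[1… n ] λ a → ∑[1… n ] λ y →
                 [ a ℕ.* x ℕ.+ b ℕ.* y ≡ n ] * ([ x < y ] * φ (a ℕ.+ b) b))
        ≡⟨ reorder _ ⟨
      ∑[a*x+b*y≡ n ] (λ a b x y → [ x < y ] * φ (a ℕ.+ b) b) ∎
      where
      open ≡-Reasoning
      reorder : ∀ (F : ℕ → ℕ → ℕ → ℕ → ℤ) →
        ∑[1… n ] (λ a → ∑[1… n ] λ b → ∑[1… n ] λ x → ∑[1… n ] λ y → F a b x y) ≡
        ∑[1… n ] (λ b → ∑[1… n ] λ x → ∑[1… n ] λ a → ∑[1… n ] λ y → F a b x y)
      reorder F = trans (∑-comm n n _) (∑-cong-≗ n λ b → ∑-comm n n _)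

    ∑[a*x+b*y≡]-shear′ : ∀ (φ : ℕ → ℕ → ℤ) →
      ∑[a*x+b*y≡ n ] (λ a b x y → [ a < b ] * φ a b) ≡ ∑[a*x+b*y≡ n ] (λ a b x y → [ y < x ] * φ a (a ℕ.+ b))
    ∑[a*x+b*y≡]-shear′ φ = begin
      ∑[a*x+b*y≡ n ] (λ a b x y → [ a < b ] * φ a b)
        ≡⟨ ∑[a*x+b*y≡]-swap (λ a b x y → [ a < b ] * φ a b) ⟨
      ∑[a*x+b*y≡ n ] (λ a b x y → [ b < a ] * φ b a)
        ≡⟨ ∑[a*x+b*y≡]-shear (λ a b → φ b a) ⟩
      ∑[a*x+b*y≡ n ] (λ a b x y → [ x < y ] * φ b (a ℕ.+ b))
        ≡⟨ ∑[a*x+b*y≡]-cong (λ a b x y → cong (λ k → [ x < y ] * φ b k) (ℕ.+-comm a b)) ⟩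
      ∑[a*x+b*y≡ n ] (λ a b x y → [ x < y ] * φ b (b ℕ.+ a))
        ≡⟨ ∑[a*x+b*y≡]-swap (λ a b x y → [ y < x ] * φ a (a ℕ.+ b)) ⟩
      ∑[a*x+b*y≡ n ] (λ a b x y → [ y < x ] * φ a (a ℕ.+ b)) ∎
      where open ≡-Reasoning

    ∑[a*x+b*y≡]-diagonalᵃᵇ : ∀ (ψ : ℕ → ℤ) →
      ∑[a*x+b*y≡ n ] (λ a b x y → [ a ≡ b ] * ψ a) ≡ ∑[d*e≡ n ] (λ d e → ψ d * + (e ∸ 1))
    ∑[a*x+b*y≡]-diagonalᵃᵇ ψ = ∑-cong n fixed-a
      where
      open ≡-Reasoning
      pull : ∀ i p q → i * (p * q) ≡ p * (i * q)
      pull = x∙yz≈y∙xz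
      count : ∀ c t i → t * (i * c) ≡ i * (c * t)
      count = solve-∀
      fixed-a : ∀ a → 1 ≤ a → a ≤ n →
        ∑[1… n ] (λ b → ∑[1… n ] λ x → ∑[1… n ] λ y → [ a ℕ.* x ℕ.+ b ℕ.* y ≡ n ] * ([ a ≡ b ] * ψ a)) ≡
        ∑[1… n ] (λ e → [ a ℕ.* e ≡ n ] * (ψ a * + (e ∸ 1)))
      fixed-a a 1≤a a≤n = begin
        ∑[1… n ] (λ b → ∑[1… n ] λ x → ∑[1… n ] λ y → [ a ℕ.* x ℕ.+ b ℕ.* y ≡ n ] * ([ a ≡ b ] * ψ a))
          ≡⟨ ∑-cong-≗ n (λ b → trans (∑-cong-≗ n λ x → trans (∑-cong-≗ n λ y →
               trans (pull (I b x y) [ a ≡ b ] (ψ a)) (cong (_* (I b x y * ψ a)) ([≡]-sym a b)))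
               (∑-distribˡ-* n [ b ≡ a ] (λ y → I b x y * ψ a)))
               (∑-distribˡ-* n [ b ≡ a ] (λ x → ∑[1… n ] λ y → I b x y * ψ a))) ⟩
        ∑[1… n ] (λ b → [ b ≡ a ] * ∑[1… n ] λ x → ∑[1… n ] λ y → [ a ℕ.* x ℕ.+ b ℕ.* y ≡ n ] * ψ a)
          ≡⟨ ∑-select (λ b → ∑[1… n ] λ x → ∑[1… n ] λ y → I b x y * ψ a) 1≤a a≤n ⟩
        ∑[1… n ] (λ x → ∑[1… n ] λ y → [ a ℕ.* x ℕ.+ a ℕ.* y ≡ n ] * ψ a)
          ≡⟨ ∑-cong-≗ n (λ x → ∑-cong-≗ n λ y → cong (λ k → [ k ≡ n ] * ψ a) (ℕ.*-distribˡ-+ a x y)) ⟨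
        ∑[1… n ] (λ x → ∑[1… n ] λ y → h (x ℕ.+ y))
          ≡⟨ ∑-cong-≗ n (λ x → ∑-shift n x h λ s n<s →
               trans (cong (_* ψ a) ([≡]-above (ℕ.<-≤-trans n<s (m≤n*m⁺ s 1≤a)))) (ℤ.*-zeroˡ (ψ a))) ⟩
        ∑[1… n ] (λ x → ∑[1… n ] λ s → [ x < s ] * h s)
          ≡⟨ ∑-comm n n _ ⟩
        ∑[1… n ] (λ s → ∑[1… n ] λ x → [ x < s ] * h s)
          ≡⟨ ∑-cong n (λ { (suc t) _ s≤n → ∑-below n t (λ _ → h (suc t)) (ℕ.<⇒≤ s≤n) }) ⟩
        ∑[1… n ] (λ s → ∑[1… s ∸ 1 ] λ _ → h s)
          ≡⟨ ∑-cong n (λ { (suc t) _ _ → trans (∑-const t (h (suc t))) (count (ψ a) (+ t) [ a ℕ.* suc t ≡ n ]) }) ⟩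
        ∑[1… n ] (λ e → [ a ℕ.* e ≡ n ] * (ψ a * + (e ∸ 1))) ∎
        where
        I : ℕ → ℕ → ℕ → ℤ
        I b x y = [ a ℕ.* x ℕ.+ b ℕ.* y ≡ n ]
        h : ℕ → ℤ
        h s = [ a ℕ.* s ≡ n ] * ψ a

    ∑[a*x+b*y≡]-diagonalˣʸ : ∀ (φ : ℕ → ℕ → ℤ) →
      ∑[a*x+b*y≡ n ] (λ a b x y → [ x ≡ y ] * φ a b) ≡ ∑[d*e≡ n ] (λ d e → ∑[1… d ∸ 1 ] λ a → φ a (d ∸ a))
    ∑[a*x+b*y≡]-diagonalˣʸ φ = begin
      ∑[a*x+b*y≡ n ] (λ a b x y → [ x ≡ y ] * φ a b)
        ≡⟨ ∑-cong-≗ n (λ a → ∑-cong-≗ n λ b → ∑-cong n λ x 1≤x x≤n → collapse-y a b 1≤x x≤n) ⟩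
      ∑[1… n ] (λ a → ∑[1… n ] λ b → h a (a ℕ.+ b))
        ≡⟨ ∑-cong-≗ n (λ a → ∑-shift n a (h a) (λ m n<m → ∑-zero n λ x 1≤x _ →
             trans (cong (_* φ a (m ∸ a)) ([≡]-above (ℕ.<-≤-trans n<m (m≤m*n⁺ m 1≤x)))) (ℤ.*-zeroˡ (φ a (m ∸ a))))) ⟩
      ∑[1… n ] (λ a → ∑[1… n ] λ m → [ a < m ] * h a m)
        ≡⟨ ∑-cong-≗ n (λ a → ∑-cong-≗ n λ m → sym (∑-distribˡ-* n [ a < m ] _)) ⟩
      ∑[1… n ] (λ a → ∑[1… n ] λ m → ∑[1… n ] λ x → [ a < m ] * ([ m ℕ.* x ≡ n ] * φ a (m ∸ a)))
        ≡⟨ trans (∑-comm n n _) (∑-cong-≗ n λ m → ∑-comm n n _) ⟩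
      ∑[1… n ] (λ m → ∑[1… n ] λ x → ∑[1… n ] λ a → [ a < m ] * ([ m ℕ.* x ≡ n ] * φ a (m ∸ a)))
        ≡⟨ ∑-cong-≗ n (λ m → ∑-cong-≗ n λ x →
             trans (∑-cong-≗ n λ a → x∙yz≈y∙xz [ a < m ] [ m ℕ.* x ≡ n ] (φ a (m ∸ a)))
                   (∑-distribˡ-* n [ m ℕ.* x ≡ n ] λ a → [ a < m ] * φ a (m ∸ a))) ⟩
      ∑[1… n ] (λ m → ∑[1… n ] λ x → [ m ℕ.* x ≡ n ] * ∑[1… n ] λ a → [ a < m ] * φ a (m ∸ a))
        ≡⟨ ∑-cong n (λ { (suc t) _ m≤n → ∑-cong-≗ n λ x →
             cong (_*_ [ suc t ℕ.* x ≡ n ]) (∑-below n t (λ a → φ a (suc t ∸ a)) (ℕ.<⇒≤ m≤n)) }) ⟩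
      ∑[d*e≡ n ] (λ d e → ∑[1… d ∸ 1 ] λ a → φ a (d ∸ a)) ∎
      where
      open ≡-Reasoning
      h : ℕ → ℕ → ℤ
      h a m = ∑[1… n ] λ x → [ m ℕ.* x ≡ n ] * φ a (m ∸ a)
      collapse-y : ∀ a b {x} → 1 ≤ x → x ≤ n →
        ∑[1… n ] (λ y → [ a ℕ.* x ℕ.+ b ℕ.* y ≡ n ] * ([ x ≡ y ] * φ a b)) ≡
        [ (a ℕ.+ b) ℕ.* x ≡ n ] * φ a (a ℕ.+ b ∸ a)
      collapse-y a b {x} 1≤x x≤n = begin
        ∑[1… n ] (λ y → [ a ℕ.* x ℕ.+ b ℕ.* y ≡ n ] * ([ x ≡ y ] * φ a b))
          ≡⟨ ∑-cong-≗ n (λ y → trans (x∙yz≈y∙xz (I y) [ x ≡ y ] (φ a b)) (cong (_* (I y * φ a b)) ([≡]-sym x y))) ⟩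
        ∑[1… n ] (λ y → [ y ≡ x ] * ([ a ℕ.* x ℕ.+ b ℕ.* y ≡ n ] * φ a b))
          ≡⟨ ∑-select (λ y → [ a ℕ.* x ℕ.+ b ℕ.* y ≡ n ] * φ a b) 1≤x x≤n ⟩
        [ a ℕ.* x ℕ.+ b ℕ.* x ≡ n ] * φ a b
          ≡⟨ cong₂ (λ k l → [ k ≡ n ] * φ a l) (ℕ.*-distribʳ-+ x a b) (ℕ.m+n∸m≡n a b) ⟨
        [ (a ℕ.+ b) ℕ.* x ≡ n ] * φ a (a ℕ.+ b ∸ a) ∎
        where
        I : ℕ → ℤ
        I y = [ a ℕ.* x ℕ.+ b ℕ.* y ≡ n ]

    liouville : ∀ (g G : ℕ → ℕ → ℤ) → (∀ a b → g (a ℕ.+ b) b ≡ G a b) → (∀ a b → g a (a ℕ.+ b) ≡ G a b) →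
      ∑[a*x+b*y≡ n ] (λ a b x y → g a b - G a b)
        ≡ ∑[d*e≡ n ] (λ d e → g d d * + (e ∸ 1)) - ∑[d*e≡ n ] (λ d e → ∑[1… d ∸ 1 ] λ a → G a (d ∸ a))
    liouville g G g-shiftˡ g-shiftʳ = begin
      ∑[a*x+b*y≡ n ] (λ a b x y → g a b - G a b)
        ≡⟨ ∑[a*x+b*y≡]-distrib-- (λ a b x y → g a b) (λ a b x y → G a b) ⟩
      ∑[a*x+b*y≡ n ] (λ a b x y → g a b) - ∑[a*x+b*y≡ n ] (λ a b x y → G a b)
        ≡⟨ cong₂ _-_ (∑[a*x+b*y≡]-trichotomy (λ a b x y → a) (λ a b x y → b) (λ a b x y → g a b))
                     (∑[a*x+b*y≡]-trichotomy (λ a b x y → x) (λ a b x y → y) (λ a b x y → G a b)) ⟩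
      (g[a<b] + g[a≡b] + g[b<a]) - (G[x<y] + G[x≡y] + G[y<x])
        ≡⟨ cong₂ (λ p q → (p + g[a≡b] + q) - (G[x<y] + G[x≡y] + G[y<x])) g[a<b]≡G[y<x] g[b<a]≡G[x<y] ⟩
      (G[y<x] + g[a≡b] + G[x<y]) - (G[x<y] + G[x≡y] + G[y<x])
        ≡⟨ cancel G[y<x] g[a≡b] G[x<y] G[x≡y] ⟩
      g[a≡b] - G[x≡y]
        ≡⟨ cong₂ _-_ (trans (∑[a*x+b*y≡]-cong λ a b x y → [≡]*-cong a b (g a b) (g a a) λ a≡b → cong (g a) (sym a≡b))
                            (∑[a*x+b*y≡]-diagonalᵃᵇ λ d → g d d))
                     (∑[a*x+b*y≡]-diagonalˣʸ G) ⟩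
      ∑[d*e≡ n ] (λ d e → g d d * + (e ∸ 1)) - ∑[d*e≡ n ] (λ d e → ∑[1… d ∸ 1 ] λ a → G a (d ∸ a)) ∎
      where
      open ≡-Reasoning
      g[a<b] g[a≡b] g[b<a] G[x<y] G[x≡y] G[y<x] : ℤ
      g[a<b] = ∑[a*x+b*y≡ n ] (λ a b x y → [ a < b ] * g a b)
      g[a≡b] = ∑[a*x+b*y≡ n ] (λ a b x y → [ a ≡ b ] * g a b)
      g[b<a] = ∑[a*x+b*y≡ n ] (λ a b x y → [ b < a ] * g a b)
      G[x<y] = ∑[a*x+b*y≡ n ] (λ a b x y → [ x < y ] * G a b)
      G[x≡y] = ∑[a*x+b*y≡ n ] (λ a b x y → [ x ≡ y ] * G a b)
      G[y<x] = ∑[a*x+b*y≡ n ] (λ a b x y → [ y < x ] * G a b)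
      g[a<b]≡G[y<x] : g[a<b] ≡ G[y<x]
      g[a<b]≡G[y<x] = trans (∑[a*x+b*y≡]-shear′ g) (∑[a*x+b*y≡]-cong λ a b x y → cong (_*_ [ y < x ]) (g-shiftʳ a b))
      g[b<a]≡G[x<y] : g[b<a] ≡ G[x<y]
      g[b<a]≡G[x<y] = trans (∑[a*x+b*y≡]-shear g) (∑[a*x+b*y≡]-cong λ a b x y → cong (_*_ [ x < y ]) (g-shiftˡ a b))
      cancel : ∀ p q r s → (p + q + r) - (r + s + p) ≡ q - s
      cancel = solve-∀

  -- The kernels g and G

  ε : ℕ → ℤ
  ε d = - sign d

  ε-+ : ∀ a b → ε (a ℕ.+ b) ≡ - (ε a * ε b)
  ε-+ zero    b = sym (trans (cong -_ (ℤ.-1*i≡-i (ε b))) (ℤ.neg-involutive (ε b)))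
  ε-+ (suc a) b = trans (cong -_ (ε-+ a b)) (cong -_ (ℤ.neg-distribˡ-* (ε a) (ε b)))

  ε≡±1 : ∀ d → ε d ≡ 1ℤ ⊎ ε d ≡ -1ℤ
  ε≡±1 zero = inj₂ refl
  ε≡±1 (suc d) with ε≡±1 d
  ... | inj₁ εd≡1  = inj₂ (cong -_ εd≡1)
  ... | inj₂ εd≡-1 = inj₁ (cong -_ εd≡-1)

  ε*ε≡1 : ∀ d → ε d * ε d ≡ 1ℤ
  ε*ε≡1 d with ε≡±1 d
  ... | inj₁ εd≡1  rewrite εd≡1  = refl
  ... | inj₂ εd≡-1 rewrite εd≡-1 = refl

  ε-∸ : ∀ {a m} → a ≤ m → ε (m ∸ a) ≡ - (ε a * ε m)
  ε-∸ {a} {m} a≤m = begin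
    ε (m ∸ a)                                ≡⟨ ℤ.*-identityˡ _ ⟨
    1ℤ * ε (m ∸ a)                           ≡⟨ cong (_* ε (m ∸ a)) (ε*ε≡1 a) ⟨
    ε a * ε a * ε (m ∸ a)                    ≡⟨ regroup (ε a) (ε (m ∸ a)) ⟩
    - (ε a * - (ε a * ε (m ∸ a)))            ≡⟨ cong (λ k → - (ε a * k)) (ε-+ a (m ∸ a)) ⟨
    - (ε a * ε (a ℕ.+ (m ∸ a)))              ≡⟨ cong (λ k → - (ε a * ε k)) (ℕ.m+[n∸m]≡n a≤m) ⟩
    - (ε a * ε m)                            ∎
    where
    open ≡-Reasoning
    regroup : ∀ s t → s * s * t ≡ - (s * - (s * t))
    regroup = solve-∀

  -- The ring solver does not unfold κ, so identities about κ are stated with κ written out.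
  κ : ℤ → ℤ → ℤ → ℤ → ℤ → ℤ
  κ c s t A B = c * (s * t * (A * B)) + s * (1ℤ - t) * (A * A) + t * (1ℤ - s) * (B * B)

  g G : ℕ → ℕ → ℤ
  g a b = κ (+ 2)   (ε a) (ε b) (+ a) (+ b)
  G a b = κ (- + 2) (ε a) (ε b) (+ a) (+ b)

  g-G : ∀ a b → g a b - G a b ≡ + 4 * (ε a * + a * (ε b * + b))
  g-G a b = identity (ε a) (ε b) (+ a) (+ b)
    where
    identity : ∀ s t A B →
      (+ 2 * (s * t * (A * B)) + s * (1ℤ - t) * (A * A) + t * (1ℤ - s) * (B * B))
        - (- + 2 * (s * t * (A * B)) + s * (1ℤ - t) * (A * A) + t * (1ℤ - s) * (B * B))
      ≡ + 4 * (s * A * (t * B))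
    identity = solve-∀

  g-diagonal : ∀ a → g a a ≡ + 2 * (ε a * (+ a * + a))
  g-diagonal a = identity (ε a) (+ a)
    where
    identity : ∀ s A → + 2 * (s * s * (A * A)) + s * (1ℤ - s) * (A * A) + s * (1ℤ - s) * (A * A) ≡ + 2 * (s * (A * A))
    identity = solve-∀

  κ-sym : ∀ c s t A B → κ c s t A B ≡ κ c t s B A
  κ-sym = identity
    where
    identity : ∀ c s t A B →
      c * (s * t * (A * B)) + s * (1ℤ - t) * (A * A) + t * (1ℤ - s) * (B * B)
      ≡ c * (t * s * (B * A)) + t * (1ℤ - s) * (B * B) + s * (1ℤ - t) * (A * A)
    identity = solve-∀

  g-shiftˡ : ∀ a b → g (a ℕ.+ b) b ≡ G a b
  g-shiftˡ a b = trans (cong₂ (λ s A → κ (+ 2) s (ε b) A (+ b)) (ε-+ a b) (ℤ.pos-+ a b))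
                       (by-cases (ε≡±1 b))
    where
    by-cases : ε b ≡ 1ℤ ⊎ ε b ≡ -1ℤ → κ (+ 2) (- (ε a * ε b)) (ε b) (+ a + + b) (+ b) ≡ G a b
    by-cases (inj₁ εb≡1)  rewrite εb≡1  = identity (ε a) (+ a) (+ b)
      where
      identity : ∀ s A B →
        + 2 * (- (s * 1ℤ) * 1ℤ * ((A + B) * B)) + - (s * 1ℤ) * (1ℤ - 1ℤ) * ((A + B) * (A + B))
          + 1ℤ * (1ℤ - - (s * 1ℤ)) * (B * B)
        ≡ - + 2 * (s * 1ℤ * (A * B)) + s * (1ℤ - 1ℤ) * (A * A) + 1ℤ * (1ℤ - s) * (B * B)
      identity = solve-∀
    by-cases (inj₂ εb≡-1) rewrite εb≡-1 = identity (ε a) (+ a) (+ b)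
      where
      identity : ∀ s A B →
        + 2 * (- (s * -1ℤ) * -1ℤ * ((A + B) * B)) + - (s * -1ℤ) * (1ℤ - -1ℤ) * ((A + B) * (A + B))
          + -1ℤ * (1ℤ - - (s * -1ℤ)) * (B * B)
        ≡ - + 2 * (s * -1ℤ * (A * B)) + s * (1ℤ - -1ℤ) * (A * A) + -1ℤ * (1ℤ - s) * (B * B)
      identity = solve-∀

  g-shiftʳ : ∀ a b → g a (a ℕ.+ b) ≡ G a b
  g-shiftʳ a b = begin
    g a (a ℕ.+ b)   ≡⟨ κ-sym (+ 2) (ε a) (ε (a ℕ.+ b)) (+ a) (+ (a ℕ.+ b)) ⟩
    g (a ℕ.+ b) a   ≡⟨ cong (λ k → g k a) (ℕ.+-comm a b) ⟩
    g (b ℕ.+ a) a   ≡⟨ g-shiftˡ b a ⟩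
    G b a           ≡⟨ κ-sym (- + 2) (ε b) (ε a) (+ b) (+ a) ⟩
    G a b           ∎
    where open ≡-Reasoning

  -- Sums of G along antidiagonals

  double : ℕ → ℕ
  double zero    = zero
  double (suc n) = suc (suc (double n))

  double-mono-≤ : ∀ {m n} → m ≤ n → double m ≤ double n
  double-mono-≤ z≤n       = z≤n
  double-mono-≤ (s≤s m≤n) = s≤s (s≤s (double-mono-≤ m≤n))

  pos-double : ∀ n → + double n ≡ + 2 * + n
  pos-double zero    = refl
  pos-double (suc n) = trans (cong (_+_ (+ 2)) (pos-double n)) (sym (ℤ.*-distribˡ-+ (+ 2) 1ℤ (+ n)))

  pos-pred-double : ∀ {n} → 1 ≤ n → + ℕ.pred (double n) ≡ + 2 * + n - 1ℤ
  pos-pred-double {suc n} _ = trans (cong (_+_ 1ℤ) (pos-double n)) (identity (+ n))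
    where
    identity : ∀ N → 1ℤ + + 2 * N ≡ + 2 * (1ℤ + N) - 1ℤ
    identity = solve-∀

  ε-double : ∀ n → ε (double n) ≡ -1ℤ
  ε-double zero    = refl
  ε-double (suc n) = trans (ℤ.neg-involutive (ε (double n))) (ε-double n)

  ε-pred-double : ∀ {n} → 1 ≤ n → ε (ℕ.pred (double n)) ≡ 1ℤ
  ε-pred-double {suc n} _ = cong -_ (ε-double n)

  data Parity : ℕ → Set where
    even : ∀ s → Parity (double s)
    odd  : ∀ s → Parity (suc (double s))

  parity : ∀ n → Parity n
  parity zero = even zero
  parity (suc n) with parity n
  ... | even s = odd s
  ... | odd s  = even (suc s)

  ∑-pairs : ∀ s (f : ℕ → ℤ) → ∑[1… double s ] f ≡ ∑[1… s ] (λ t → f (ℕ.pred (double t)) + f (double t))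
  ∑-pairs zero    f = refl
  ∑-pairs (suc s) f =
    trans (cong (λ r → f 1 + (f 2 + r)) (trans (∑-pairs s (f ∘ suc ∘ suc)) (∑-cong s λ { (suc t) _ _ → refl })))
          (sym (ℤ.+-assoc (f 1) (f 2) _))

  κ-odd-even : ∀ A B → κ (- + 2) 1ℤ -1ℤ A B ≡ + 2 * A * (A + B)
  κ-odd-even = identity
    where
    identity : ∀ A B → - + 2 * (1ℤ * -1ℤ * (A * B)) + 1ℤ * (1ℤ - -1ℤ) * (A * A) + -1ℤ * (1ℤ - 1ℤ) * (B * B)
                       ≡ + 2 * A * (A + B)
    identity = solve-∀

  κ-even-odd : ∀ A B → κ (- + 2) -1ℤ 1ℤ A B ≡ + 2 * B * (A + B)
  κ-even-odd = identity
    where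
    identity : ∀ A B → - + 2 * (-1ℤ * 1ℤ * (A * B)) + -1ℤ * (1ℤ - 1ℤ) * (A * A) + 1ℤ * (1ℤ - -1ℤ) * (B * B)
                       ≡ + 2 * B * (A + B)
    identity = solve-∀

  κ-odd-odd : ∀ A B → κ (- + 2) 1ℤ 1ℤ A B ≡ - + 2 * (A * B)
  κ-odd-odd = identity
    where
    identity : ∀ A B → - + 2 * (1ℤ * 1ℤ * (A * B)) + 1ℤ * (1ℤ - 1ℤ) * (A * A) + 1ℤ * (1ℤ - 1ℤ) * (B * B)
                       ≡ - + 2 * (A * B)
    identity = solve-∀

  κ-even-even : ∀ A B → κ (- + 2) -1ℤ -1ℤ A B ≡ - + 2 * (A * A + A * B + B * B)
  κ-even-even = identity
    where
    identity : ∀ A B → - + 2 * (-1ℤ * -1ℤ * (A * B)) + -1ℤ * (1ℤ - -1ℤ) * (A * A) + -1ℤ * (1ℤ - -1ℤ) * (B * B)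
                       ≡ - + 2 * (A * A + A * B + B * B)
    identity = solve-∀

  G-antidiagonal : ∀ {a m} → a ≤ m → G a (m ∸ a) ≡ κ (- + 2) (ε a) (- (ε a * ε m)) (+ a) (+ m - + a)
  G-antidiagonal {a} a≤m = cong₂ (λ t B → κ (- + 2) (ε a) t (+ a) B) (ε-∸ a≤m) (pos-∸ a≤m)

  G-antidiagonal-pair : ∀ {t m} → 1 ≤ t → double t ≤ m →
    G (ℕ.pred (double t)) (m ∸ ℕ.pred (double t)) + G (double t) (m ∸ double t)
    ≡ κ (- + 2) 1ℤ (- (1ℤ * ε m)) (+ 2 * + t - 1ℤ) (+ m - (+ 2 * + t - 1ℤ))
      + κ (- + 2) -1ℤ (- (-1ℤ * ε m)) (+ 2 * + t) (+ m - + 2 * + t)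
  G-antidiagonal-pair {t} {m} 1≤t 2t≤m = begin
    G a₁ (m ∸ a₁) + G a₂ (m ∸ a₂)
      ≡⟨ cong₂ _+_ (G-antidiagonal (ℕ.≤⇒pred≤ 2t≤m)) (G-antidiagonal 2t≤m) ⟩
    term (ε a₁) (+ a₁) + term (ε a₂) (+ a₂)
      ≡⟨ cong₂ _+_ (cong₂ term (ε-pred-double 1≤t) (pos-pred-double 1≤t)) (cong₂ term (ε-double t) (pos-double t)) ⟩
    term 1ℤ (+ 2 * + t - 1ℤ) + term -1ℤ (+ 2 * + t) ∎
    where
    open ≡-Reasoning
    a₁ a₂ : ℕ
    a₁ = ℕ.pred (double t)
    a₂ = double t
    term : ℤ → ℤ → ℤ
    term e A = κ (- + 2) e (- (e * ε m)) A (+ m - A)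

  G-antidiagonal-pair-odd : ∀ {t m} → 1 ≤ t → double t ≤ m → ε m ≡ 1ℤ →
    G (ℕ.pred (double t)) (m ∸ ℕ.pred (double t)) + G (double t) (m ∸ double t) ≡ + 2 * + m * (+ m - 1ℤ)
  G-antidiagonal-pair-odd {t} {m} 1≤t 2t≤m εm≡1 = begin
    G (ℕ.pred (double t)) (m ∸ ℕ.pred (double t)) + G (double t) (m ∸ double t)
      ≡⟨ G-antidiagonal-pair 1≤t 2t≤m ⟩
    κ (- + 2) 1ℤ (- (1ℤ * ε m)) A₁ (M - A₁) + κ (- + 2) -1ℤ (- (-1ℤ * ε m)) A₂ (M - A₂)
      ≡⟨ cong (λ e → κ (- + 2) 1ℤ (- (1ℤ * e)) A₁ (M - A₁) + κ (- + 2) -1ℤ (- (-1ℤ * e)) A₂ (M - A₂)) εm≡1 ⟩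
    κ (- + 2) 1ℤ -1ℤ A₁ (M - A₁) + κ (- + 2) -1ℤ 1ℤ A₂ (M - A₂)
      ≡⟨ cong₂ _+_ (κ-odd-even A₁ (M - A₁)) (κ-even-odd A₂ (M - A₂)) ⟩
    + 2 * A₁ * (A₁ + (M - A₁)) + + 2 * (M - A₂) * (A₂ + (M - A₂))
      ≡⟨ identity M (+ t) ⟩
    + 2 * M * (M - 1ℤ) ∎
    where
    open ≡-Reasoning
    M A₁ A₂ : ℤ
    M = + m
    A₁ = + 2 * + t - 1ℤ
    A₂ = + 2 * + t
    identity : ∀ M T → + 2 * (+ 2 * T - 1ℤ) * ((+ 2 * T - 1ℤ) + (M - (+ 2 * T - 1ℤ)))
                       + + 2 * (M - + 2 * T) * (+ 2 * T + (M - + 2 * T))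
                       ≡ + 2 * M * (M - 1ℤ)
    identity = solve-∀

  G-antidiagonal-pair-even : ∀ {t m} → 1 ≤ t → double t ≤ m → ε m ≡ -1ℤ →
    G (ℕ.pred (double t)) (m ∸ ℕ.pred (double t)) + G (double t) (m ∸ double t)
    ≡ - + 2 * (+ m * + m) + + 2 * + m + + 2 + - + 4 * (+ 2 * + t)
  G-antidiagonal-pair-even {t} {m} 1≤t 2t≤m εm≡-1 = begin
    G (ℕ.pred (double t)) (m ∸ ℕ.pred (double t)) + G (double t) (m ∸ double t)
      ≡⟨ G-antidiagonal-pair 1≤t 2t≤m ⟩
    κ (- + 2) 1ℤ (- (1ℤ * ε m)) A₁ (M - A₁) + κ (- + 2) -1ℤ (- (-1ℤ * ε m)) A₂ (M - A₂)
      ≡⟨ cong (λ e → κ (- + 2) 1ℤ (- (1ℤ * e)) A₁ (M - A₁) + κ (- + 2) -1ℤ (- (-1ℤ * e)) A₂ (M - A₂)) εm≡-1 ⟩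
    κ (- + 2) 1ℤ 1ℤ A₁ (M - A₁) + κ (- + 2) -1ℤ -1ℤ A₂ (M - A₂)
      ≡⟨ cong₂ _+_ (κ-odd-odd A₁ (M - A₁)) (κ-even-even A₂ (M - A₂)) ⟩
    - + 2 * (A₁ * (M - A₁)) + - + 2 * (A₂ * A₂ + A₂ * (M - A₂) + (M - A₂) * (M - A₂))
      ≡⟨ identity M (+ t) ⟩
    - + 2 * (M * M) + + 2 * M + + 2 + - + 4 * (+ 2 * + t) ∎
    where
    open ≡-Reasoning
    M A₁ A₂ : ℤ
    M = + m
    A₁ = + 2 * + t - 1ℤ
    A₂ = + 2 * + t
    identity : ∀ M T → - + 2 * ((+ 2 * T - 1ℤ) * (M - (+ 2 * T - 1ℤ)))
                       + - + 2 * (+ 2 * T * (+ 2 * T) + + 2 * T * (M - + 2 * T) + (M - + 2 * T) * (M - + 2 * T))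
                       ≡ - + 2 * (M * M) + + 2 * M + + 2 + - + 4 * (+ 2 * T)
    identity = solve-∀

  ∑-G-antidiagonal-odd : ∀ s → ∑[1… double s ] (λ a → G a (suc (double s) ∸ a))
                             ≡ + suc (double s) * (+ double s * + double s)
  ∑-G-antidiagonal-odd s = begin
    ∑[1… double s ] f                                       ≡⟨ ∑-pairs s f ⟩
    ∑[1… s ] (λ t → f (ℕ.pred (double t)) + f (double t))   ≡⟨ ∑-cong s pair ⟩
    ∑[1… s ] (λ _ → + 2 * M * (M - 1ℤ))                     ≡⟨ ∑-const s _ ⟩
    + s * (+ 2 * M * (M - 1ℤ))                              ≡⟨ identity (+ s) (+ double s) (pos-double s) ⟩
    M * (+ double s * + double s)                           ∎
    where
    open ≡-Reasoning
    M : ℤ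
    M = + suc (double s)
    f : ℕ → ℤ
    f a = G a (suc (double s) ∸ a)
    pair : ∀ t → 1 ≤ t → t ≤ s → f (ℕ.pred (double t)) + f (double t) ≡ + 2 * M * (M - 1ℤ)
    pair t 1≤t t≤s =
      G-antidiagonal-pair-odd 1≤t (ℕ.m≤n⇒m≤1+n (double-mono-≤ t≤s)) (cong -_ (ε-double s))
    identity : ∀ S D → D ≡ + 2 * S → S * (+ 2 * (1ℤ + D) * (1ℤ + D - 1ℤ)) ≡ (1ℤ + D) * (D * D)
    identity S D refl = ring S
      where
      ring : ∀ S → S * (+ 2 * (1ℤ + + 2 * S) * (1ℤ + + 2 * S - 1ℤ)) ≡ (1ℤ + + 2 * S) * (+ 2 * S * (+ 2 * S))
      ring = solve-∀

  ∑-G-antidiagonal-even : ∀ s → ∑[1… suc (double s) ] (λ a → G a (suc (suc (double s)) ∸ a))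
                              ≡ - (+ suc (suc (double s)) * (+ suc (double s) * + suc (double s)))
  ∑-G-antidiagonal-even s = begin
    ∑[1… suc (double s) ] f
      ≡⟨ ∑-last (double s) f ⟩
    ∑[1… double s ] f + f (suc (double s))
      ≡⟨ cong₂ _+_ (trans (∑-pairs s f) (∑-cong s pair)) last ⟩
    ∑[1… s ] (λ t → c + - + 4 * (+ 2 * + t)) + - + 2 * (M - 1ℤ)
      ≡⟨ cong (_+ - + 2 * (M - 1ℤ)) (∑-affine s c (- + 4)) ⟩
    + s * c + - + 4 * (+ s * (+ s + 1ℤ)) + - + 2 * (M - 1ℤ)
      ≡⟨ identity (+ s) (+ double s) (pos-double s) ⟩
    - (M * (+ suc (double s) * + suc (double s))) ∎
    where
    open ≡-Reasoning
    M c : ℤ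
    M = + suc (suc (double s))
    c = - + 2 * (M * M) + + 2 * M + + 2
    f : ℕ → ℤ
    f a = G a (suc (suc (double s)) ∸ a)
    pair : ∀ t → 1 ≤ t → t ≤ s → f (ℕ.pred (double t)) + f (double t) ≡ c + - + 4 * (+ 2 * + t)
    pair t 1≤t t≤s = G-antidiagonal-pair-even 1≤t (double-mono-≤ {t} {suc s} (ℕ.m≤n⇒m≤1+n t≤s)) (ε-double (suc s))
    last : f (suc (double s)) ≡ - + 2 * (M - 1ℤ)
    last = begin
      f (suc (double s))
        ≡⟨ G-antidiagonal (ℕ.n≤1+n (suc (double s))) ⟩
      κ (- + 2) (ε (suc (double s))) (- (ε (suc (double s)) * ε (double (suc s)))) (M - 1ℤ) (M - (M - 1ℤ))
        ≡⟨ cong₂ (λ e e′ → κ (- + 2) e (- (e * e′)) (M - 1ℤ) (M - (M - 1ℤ)))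
                 (cong -_ (ε-double s)) (ε-double (suc s)) ⟩
      κ (- + 2) 1ℤ 1ℤ (M - 1ℤ) (M - (M - 1ℤ))
        ≡⟨ κ-odd-odd (M - 1ℤ) (M - (M - 1ℤ)) ⟩
      - + 2 * ((M - 1ℤ) * (M - (M - 1ℤ)))
        ≡⟨ simplify M ⟩
      - + 2 * (M - 1ℤ) ∎
      where
      simplify : ∀ M → - + 2 * ((M - 1ℤ) * (M - (M - 1ℤ))) ≡ - + 2 * (M - 1ℤ)
      simplify = solve-∀
    identity : ∀ S D → D ≡ + 2 * S →
      S * (- + 2 * ((+ 2 + D) * (+ 2 + D)) + + 2 * (+ 2 + D) + + 2) + - + 4 * (S * (S + 1ℤ)) + - + 2 * (+ 2 + D - 1ℤ)
      ≡ - ((+ 2 + D) * ((1ℤ + D) * (1ℤ + D)))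
    identity S D refl = ring S
      where
      ring : ∀ S →
        S * (- + 2 * ((+ 2 + + 2 * S) * (+ 2 + + 2 * S)) + + 2 * (+ 2 + + 2 * S) + + 2) + - + 4 * (S * (S + 1ℤ))
          + - + 2 * (+ 2 + + 2 * S - 1ℤ)
        ≡ - ((+ 2 + + 2 * S) * ((1ℤ + + 2 * S) * (1ℤ + + 2 * S)))
      ring = solve-∀

  ∑-G-antidiagonal : ∀ k → ∑[1… k ] (λ a → G a (suc k ∸ a)) ≡ ε (suc k) * (+ suc k * (+ k * + k))
  ∑-G-antidiagonal k with parity k
  ... | even s =
    trans (∑-G-antidiagonal-odd s) (sym (trans (cong (λ e → - e * X) (ε-double s)) (ℤ.*-identityˡ X)))
    where X = + suc (double s) * (+ double s * + double s)
  ... | odd s  =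
    trans (∑-G-antidiagonal-even s) (sym (trans (cong (_* X) (ε-double (suc s))) (ℤ.-1*i≡-i X)))
    where X = + suc (suc (double s)) * (+ suc (double s) * + suc (double s))

  -- Divisor sums and their convolution

  sumℤ : List ℤ → ℤ
  sumℤ = foldr _+_ 0ℤ

  sumℤ-filter : ∀ {p} {P : Pred ℕ p} (P? : Decidable P) (h : ℕ → ℤ) xs →
                sumℤ (map h (filter P? xs)) ≡ sumℤ (map (λ d → 𝟙 (does (P? d)) * h d) xs)
  sumℤ-filter P? h []       = refl
  sumℤ-filter P? h (x ∷ xs) with does (P? x)
  ... | true  = cong₂ _+_ (sym (ℤ.*-identityˡ (h x))) (sumℤ-filter P? h xs)
  ... | false = trans (sumℤ-filter P? h xs) (sym (ℤ.+-identityˡ _))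

  sumℤ-applyUpTo : ∀ (h : ℕ → ℤ) (f : ℕ → ℕ) j → sumℤ (map h (applyUpTo (f ∘ suc) j)) ≡ ∑[1… j ] (h ∘ f)
  sumℤ-applyUpTo h f zero    = refl
  sumℤ-applyUpTo h f (suc j) = cong (_+_ (h (f 1))) (sumℤ-applyUpTo h (f ∘ suc) j)

  [∣]-as-∑ : ∀ {d j} → 1 ≤ d → 1 ≤ j → 𝟙 (does (d ∣? j)) ≡ ∑[1… j ] (λ e → [ d ℕ.* e ≡ j ])
  [∣]-as-∑ {d} {j} 1≤d 1≤j with d ∣? j
  ... | no d∤j = sym (∑-zero j λ e _ _ → [≡]-no λ de≡j → d∤j (divides e (trans (sym de≡j) (ℕ.*-comm d e))))
  ... | yes (divides q j≡qd) = sym (begin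
    ∑[1… j ] (λ e → [ d ℕ.* e ≡ j ])
      ≡⟨ ∑-cong-≗ j (λ e → trans ([≡]-⇔ (cancel e) (λ e≡q → trans (cong (d ℕ.*_) e≡q) dq≡j))
                                 (sym (ℤ.*-identityʳ [ e ≡ q ]))) ⟩
    ∑[1… j ] (λ e → [ e ≡ q ] * 1ℤ)
      ≡⟨ ∑-select (λ _ → 1ℤ) 1≤q q≤j ⟩
    1ℤ ∎)
    where
    open ≡-Reasoning
    dq≡j : d ℕ.* q ≡ j
    dq≡j = trans (ℕ.*-comm d q) (sym j≡qd)
    cancel : ∀ e → d ℕ.* e ≡ j → e ≡ q
    cancel e de≡j = ℕ.*-cancelˡ-≡ e q d {{ℕ.>-nonZero 1≤d}} (trans de≡j (sym dq≡j))
    1≤q : 1 ≤ q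
    1≤q = positive q j≡qd
      where
      positive : ∀ q → j ≡ q ℕ.* d → 1 ≤ q
      positive zero    j≡0 = ⊥-elim (ℕ.<-irrefl (sym j≡0) 1≤j)
      positive (suc _) _   = s≤s z≤n
    q≤j : q ≤ j
    q≤j = subst (q ≤_) (sym j≡qd) (m≤m*n⁺ q 1≤d)

  σ*ℤ-as-∑[d*e≡] : ∀ s j → σ*ℤ s j ≡ ∑[d*e≡ j ] (λ d _ → ε d * + (d ℕ.^ s))
  σ*ℤ-as-∑[d*e≡] s j = begin
    - sumℤ (map h (filter (_∣? j) (map suc (upTo j))))
      ≡⟨ cong -_ (sumℤ-filter (_∣? j) h (map suc (upTo j))) ⟩
    - sumℤ (map (λ d → [d∣j] d * h d) (map suc (upTo j)))
      ≡⟨ cong (λ ds → - sumℤ (map (λ d → [d∣j] d * h d) ds)) (List.map-upTo suc j) ⟩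
    - sumℤ (map (λ d → [d∣j] d * h d) (applyUpTo suc j))
      ≡⟨ cong -_ (sumℤ-applyUpTo (λ d → [d∣j] d * h d) (λ d → d) j) ⟩
    - ∑[1… j ] (λ d → [d∣j] d * h d)
      ≡⟨ ∑-neg j _ ⟨
    ∑[1… j ] (λ d → - ([d∣j] d * h d))
      ≡⟨ ∑-cong j (λ d 1≤d d≤j → trans (negate-sign ([d∣j] d) (sign d) _)
                                       (cong (_* f d) ([∣]-as-∑ 1≤d (ℕ.≤-trans 1≤d d≤j)))) ⟩
    ∑[1… j ] (λ d → ∑[1… j ] (λ e → [ d ℕ.* e ≡ j ]) * f d)
      ≡⟨ ∑-cong-≗ j (λ d → sym (∑-distribʳ-* j (f d) _)) ⟩
    ∑[d*e≡ j ] (λ d _ → f d) ∎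
    where
    open ≡-Reasoning
    h f : ℕ → ℤ
    h d = sign d * + (d ℕ.^ s)
    f d = ε d * + (d ℕ.^ s)
    [d∣j] : ℕ → ℤ
    [d∣j] d = 𝟙 (does (d ∣? j))
    negate-sign : ∀ i σ x → - (i * (σ * x)) ≡ i * (- σ * x)
    negate-sign = solve-∀

  ∑-convolution : ∀ n (u : ℕ → ℤ) →
    ∑[1… n ] (λ j → ∑[d*e≡ j ] (λ d _ → u d) * ∑[d*e≡ suc n ∸ j ] (λ d _ → u d))
    ≡ ∑[a*x+b*y≡ suc n ] (λ a b x y → u a * u b)
  ∑-convolution n u = begin
    ∑[1… n ] (λ j → ∑[d*e≡ j ] (λ d _ → u d) * ∑[d*e≡ N ∸ j ] (λ d _ → u d))
      ≡⟨ ∑-cong n (λ j _ j≤n → cong₂ _*_ (sym (∑[d*e≡]-widen j u (ℕ.m≤n⇒m≤1+n j≤n)))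
                                          (sym (∑[d*e≡]-widen (N ∸ j) u (ℕ.m∸n≤m N j)))) ⟩
    ∑[1… n ] (λ j → ∑[1… N ] (λ a → ∑[1… N ] λ x → A j a x) * ∑[1… N ] (λ b → ∑[1… N ] λ y → B j b y))
      ≡⟨ ∑-cong-≗ n (λ j → trans (∑-*-∑ N N (λ a → ∑[1… N ] (A j a)) (λ b → ∑[1… N ] (B j b)))
                                 (∑-cong-≗ N λ a → ∑-cong-≗ N λ b → ∑-*-∑ N N (A j a) (B j b))) ⟩
    ∑[1… n ] (λ j → ∑[1… N ] λ a → ∑[1… N ] λ b → ∑[1… N ] λ x → ∑[1… N ] λ y → A j a x * B j b y)
      ≡⟨ trans (∑-comm n N λ j a → ∑[1… N ] λ b → ∑[1… N ] λ x → ∑[1… N ] λ y → A j a x * B j b y)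
               (∑-cong-≗ N λ a → trans (∑-comm n N λ j b → ∑[1… N ] λ x → ∑[1… N ] λ y → A j a x * B j b y)
               (∑-cong-≗ N λ b → trans (∑-comm n N λ j x → ∑[1… N ] λ y → A j a x * B j b y)
               (∑-cong-≗ N λ x → ∑-comm n N λ j y → A j a x * B j b y))) ⟩
    ∑[1… N ] (λ a → ∑[1… N ] λ b → ∑[1… N ] λ x → ∑[1… N ] λ y → ∑[1… n ] λ j → A j a x * B j b y)
      ≡⟨ ∑-cong N (λ a 1≤a _ → ∑-cong N λ b 1≤b _ → ∑-cong N λ x 1≤x _ → ∑-cong N λ y 1≤y _ →
                    ∑-select-split n (u a) (u b) (ℕ.≤-trans 1≤a (m≤m*n⁺ a 1≤x))
                                                 (ℕ.≤-trans 1≤b (m≤m*n⁺ b 1≤y))) ⟩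
    ∑[a*x+b*y≡ N ] (λ a b x y → u a * u b) ∎
    where
    open ≡-Reasoning
    N = suc n
    A B : ℕ → ℕ → ℕ → ℤ
    A j a x = [ a ℕ.* x ≡ j ] * u a
    B j b y = [ b ℕ.* y ≡ N ∸ j ] * u b

  liouville-summand : ∀ {d e n} → d ℕ.* e ≡ suc n →
    g d d * + (e ∸ 1) - ∑[1… d ∸ 1 ] (λ a → G a (d ∸ a))
    ≡ (+ 2 * + suc n - 1ℤ) * (ε d * + (d ℕ.^ 1)) - ε d * + (d ℕ.^ 3)
  liouville-summand {zero} ()
  liouville-summand {suc k} {zero}  de≡n = ⊥-elim (ℕ.0≢1+n (trans (sym (ℕ.*-zeroʳ (suc k))) de≡n))
  liouville-summand {suc k} {suc l} {n} de≡n = begin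
    g (suc k) (suc k) * + l - ∑[1… k ] (λ a → G a (suc k ∸ a))
      ≡⟨ cong₂ _-_ (cong (_* + l) (g-diagonal (suc k))) (∑-G-antidiagonal k) ⟩
    + 2 * (ε (suc k) * (+ suc k * + suc k)) * + l - ε (suc k) * (+ suc k * (+ k * + k))
      ≡⟨ identity (ε (suc k)) (+ k) (+ l) ⟩
    (+ 2 * (+ suc k * + suc l) - 1ℤ) * (ε (suc k) * (+ suc k) ^ 1) - ε (suc k) * (+ suc k) ^ 3
      ≡⟨ cong₂ (λ P A → (+ 2 * P - 1ℤ) * (ε (suc k) * A) - ε (suc k) * (+ suc k) ^ 3)
               (trans (sym (ℤ.pos-* (suc k) (suc l))) (cong +_ de≡n)) (sym (pos-^ (suc k) 1)) ⟩
    (+ 2 * + suc n - 1ℤ) * (ε (suc k) * + (suc k ℕ.^ 1)) - ε (suc k) * (+ suc k) ^ 3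
      ≡⟨ cong (λ B → (+ 2 * + suc n - 1ℤ) * (ε (suc k) * + (suc k ℕ.^ 1)) - ε (suc k) * B) (sym (pos-^ (suc k) 3)) ⟩
    (+ 2 * + suc n - 1ℤ) * (ε (suc k) * + (suc k ℕ.^ 1)) - ε (suc k) * + (suc k ℕ.^ 3) ∎
    where
    open ≡-Reasoning
    identity : ∀ s K L →
      + 2 * (s * ((1ℤ + K) * (1ℤ + K))) * L - s * ((1ℤ + K) * (K * K))
      ≡ (+ 2 * ((1ℤ + K) * (1ℤ + L)) - 1ℤ) * (s * ((1ℤ + K) * 1ℤ)) - s * ((1ℤ + K) * ((1ℤ + K) * ((1ℤ + K) * 1ℤ)))
    identity = solve-∀

  σ*ℤ-convolution : ∀ n → + 4 * ∑[1… n ] (λ j → σ*ℤ 1 j * σ*ℤ 1 (suc n ∸ j))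
                          ≡ (+ 2 * + suc n - 1ℤ) * σ*ℤ 1 (suc n) - σ*ℤ 3 (suc n)
  σ*ℤ-convolution n = begin
    + 4 * ∑[1… n ] (λ j → σ*ℤ 1 j * σ*ℤ 1 (N ∸ j))
      ≡⟨ cong (_*_ (+ 4)) (trans (∑-cong-≗ n λ j → cong₂ _*_ (σ*ℤ-as-∑[d*e≡] 1 j) (σ*ℤ-as-∑[d*e≡] 1 (N ∸ j)))
                                 (∑-convolution n u)) ⟩
    + 4 * ∑[a*x+b*y≡ N ] (λ a b x y → u a * u b)
      ≡⟨ ∑[a*x+b*y≡]-distribˡ-* N (+ 4) (λ a b x y → u a * u b) ⟨
    ∑[a*x+b*y≡ N ] (λ a b x y → + 4 * (u a * u b))
      ≡⟨ ∑[a*x+b*y≡]-cong N (λ a b x y → trans (cong₂ (λ A B → + 4 * (ε a * A * (ε b * B))) (pos-^1 a) (pos-^1 b))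
                                               (sym (g-G a b))) ⟩
    ∑[a*x+b*y≡ N ] (λ a b x y → g a b - G a b)
      ≡⟨ liouville N g G g-shiftˡ g-shiftʳ ⟩
    ∑[d*e≡ N ] (λ d e → g d d * + (e ∸ 1)) - ∑[d*e≡ N ] (λ d e → ∑[1… d ∸ 1 ] λ a → G a (d ∸ a))
      ≡⟨ ∑[d*e≡]-distrib-- N (λ d e → g d d * + (e ∸ 1)) (λ d e → ∑[1… d ∸ 1 ] λ a → G a (d ∸ a)) ⟨
    ∑[d*e≡ N ] (λ d e → g d d * + (e ∸ 1) - ∑[1… d ∸ 1 ] λ a → G a (d ∸ a))
      ≡⟨ ∑[d*e≡]-cong N (λ d e → liouville-summand {d} {e} {n}) ⟩
    ∑[d*e≡ N ] (λ d e → c * u d - u₃ d)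
      ≡⟨ ∑[d*e≡]-distrib-- N (λ d e → c * u d) (λ d _ → u₃ d) ⟩
    ∑[d*e≡ N ] (λ d e → c * u d) - ∑[d*e≡ N ] (λ d _ → u₃ d)
      ≡⟨ cong₂ _-_ (trans (∑[d*e≡]-distribˡ-* N c (λ d _ → u d)) (cong (_*_ c) (sym (σ*ℤ-as-∑[d*e≡] 1 N))))
                   (sym (σ*ℤ-as-∑[d*e≡] 3 N)) ⟩
    c * σ*ℤ 1 N - σ*ℤ 3 N ∎
    where
    open ≡-Reasoning
    N = suc n
    c : ℤ
    c = + 2 * + N - 1ℤ
    u u₃ : ℕ → ℤ
    u d = ε d * + (d ℕ.^ 1)
    u₃ d = ε d * + (d ℕ.^ 3)
    pos-^1 : ∀ a → + (a ℕ.^ 1) ≡ + a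
    pos-^1 a = cong +_ (ℕ.*-identityʳ a)

-- Passage to ℚ

open IntegerIdentity using (∑[1…_]; ∑-last; σ*ℤ-convolution)
open import Data.Nat as ℕ using (zero; suc; _≤_; z≤n; s≤s)
import Data.Nat.Properties as ℕ
import Data.Integer as ℤ
import Data.Integer.Properties as ℤ
open import Data.Integer.Tactic.RingSolver using (solve-∀)
open import Data.Rational using (ℚ; _/_; _+_; _-_; _*_; -_; toℚᵘ)
import Data.Rational.Properties as ℚ
open import Data.Rational.Unnormalised as ℚᵘ using (mkℚᵘ; *≡*; _≃_)
import Data.Rational.Unnormalised.Properties as ℚᵘ
open import Data.Rational.Solver using (module +-*-Solver)
open import Relation.Binary.PropositionalEquality using (refl; sym; trans; cong; cong₂; module ≡-Reasoning)

toℚ : ℤ.ℤ → ℚ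
toℚ i = i / 1

toℚᵘ-toℚ : ∀ i → toℚᵘ (toℚ i) ≃ mkℚᵘ i 0
toℚᵘ-toℚ i = ℚ.toℚᵘ-fromℚᵘ (mkℚᵘ i 0)

toℚ-homo-+ : ∀ a b → toℚ (a ℤ.+ b) ≡ toℚ a + toℚ b
toℚ-homo-+ a b = ℚ.toℚᵘ-injective (begin
  toℚᵘ (toℚ (a ℤ.+ b))                 ≈⟨ toℚᵘ-toℚ (a ℤ.+ b) ⟩
  mkℚᵘ (a ℤ.+ b) 0                     ≈⟨ *≡* (identity a b) ⟩
  mkℚᵘ a 0 ℚᵘ.+ mkℚᵘ b 0               ≈⟨ ℚᵘ.+-cong (toℚᵘ-toℚ a) (toℚᵘ-toℚ b) ⟨
  toℚᵘ (toℚ a) ℚᵘ.+ toℚᵘ (toℚ b)       ≈⟨ ℚ.toℚᵘ-homo-+ (toℚ a) (toℚ b) ⟨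
  toℚᵘ (toℚ a + toℚ b)                 ∎)
  where
  open ℚᵘ.≃-Reasoning
  identity : ∀ a b → (a ℤ.+ b) ℤ.* (ℤ.+ 1 ℤ.* ℤ.+ 1) ≡ (a ℤ.* ℤ.+ 1 ℤ.+ b ℤ.* ℤ.+ 1) ℤ.* ℤ.+ 1
  identity = solve-∀

toℚ-homo-* : ∀ a b → toℚ (a ℤ.* b) ≡ toℚ a * toℚ b
toℚ-homo-* a b = ℚ.toℚᵘ-injective (begin
  toℚᵘ (toℚ (a ℤ.* b))                 ≈⟨ toℚᵘ-toℚ (a ℤ.* b) ⟩
  mkℚᵘ (a ℤ.* b) 0                     ≈⟨ *≡* (identity a b) ⟩
  mkℚᵘ a 0 ℚᵘ.* mkℚᵘ b 0               ≈⟨ ℚᵘ.*-cong (toℚᵘ-toℚ a) (toℚᵘ-toℚ b) ⟨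
  toℚᵘ (toℚ a) ℚᵘ.* toℚᵘ (toℚ b)       ≈⟨ ℚ.toℚᵘ-homo-* (toℚ a) (toℚ b) ⟨
  toℚᵘ (toℚ a * toℚ b)                 ∎)
  where
  open ℚᵘ.≃-Reasoning
  identity : ∀ a b → (a ℤ.* b) ℤ.* (ℤ.+ 1 ℤ.* ℤ.+ 1) ≡ (a ℤ.* b) ℤ.* ℤ.+ 1
  identity = solve-∀

toℚ-homo-- : ∀ a b → toℚ (a ℤ.- b) ≡ toℚ a - toℚ b
toℚ-homo-- a b = trans (toℚ-homo-+ a (ℤ.- b)) (cong (_+_ (toℚ a)) (ℚ.toℚᵘ-injective (begin
  toℚᵘ (toℚ (ℤ.- b))                   ≈⟨ toℚᵘ-toℚ (ℤ.- b) ⟩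
  mkℚᵘ (ℤ.- b) 0                       ≈⟨ ℚᵘ.-‿cong (toℚᵘ-toℚ b) ⟨
  ℚᵘ.- toℚᵘ (toℚ b)                    ≈⟨ ℚ.toℚᵘ-homo‿- (toℚ b) ⟨
  toℚᵘ (- toℚ b)                       ∎)))
  where open ℚᵘ.≃-Reasoning

Σ[0…]-via-∑ : ∀ m (f : ℕ → ℚ) (h : ℕ → ℤ.ℤ) → (∀ i → 1 ≤ i → i ≤ m → f i ≡ toℚ (h i)) →
              Σ[0… m ] f ≡ f 0 + toℚ (∑[1… m ] h)
Σ[0…]-via-∑ zero    f h _  = sym (ℚ.+-identityʳ (f 0))
Σ[0…]-via-∑ (suc m) f h eq = begin
  Σ[0… m ] f + f (suc m)
    ≡⟨ cong₂ _+_ (Σ[0…]-via-∑ m f h λ i 1≤i i≤m → eq i 1≤i (ℕ.m≤n⇒m≤1+n i≤m))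
                 (eq (suc m) (s≤s z≤n) ℕ.≤-refl) ⟩
  f 0 + toℚ (∑[1… m ] h) + toℚ (h (suc m))
    ≡⟨ ℚ.+-assoc (f 0) _ _ ⟩
  f 0 + (toℚ (∑[1… m ] h) + toℚ (h (suc m)))
    ≡⟨ cong (_+_ (f 0)) (toℚ-homo-+ (∑[1… m ] h) (h (suc m))) ⟨
  f 0 + toℚ (∑[1… m ] h ℤ.+ h (suc m))
    ≡⟨ cong (λ r → f 0 + toℚ r) (∑-last m h) ⟨
  f 0 + toℚ (∑[1… suc m ] h) ∎
  where open ≡-Reasoning

σ*-as-toℚ : ∀ {j} → 1 ≤ j → σ* j ≡ toℚ (σ*ℤ 1 j)
σ*-as-toℚ {suc j} _ = refl

convolution : ℕ → ℤ.ℤ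
convolution n = ∑[1… n ] (λ j → σ*ℤ 1 j ℤ.* σ*ℤ 1 (suc n ∸ j))

Σ[0…]-σ*-convolution : ∀ n → Σ[0… suc n ] (λ j → σ* j * σ* (suc n ∸ j))
                             ≡ σ* 0 * σ* (suc n) + toℚ (convolution n) + σ* (suc n) * σ* 0
Σ[0…]-σ*-convolution n = cong₂ _+_
  (Σ[0…]-via-∑ n (λ j → σ* j * σ* (suc n ∸ j)) (λ j → σ*ℤ 1 j ℤ.* σ*ℤ 1 (suc n ∸ j)) λ j 1≤j j≤n →
    trans (cong₂ _*_ (σ*-as-toℚ 1≤j) (σ*-as-toℚ (ℕ.m<n⇒0<n∸m (s≤s j≤n))))
          (sym (toℚ-homo-* (σ*ℤ 1 j) (σ*ℤ 1 (suc n ∸ j)))))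
  (cong (λ k → σ* (suc n) * σ* k) (ℕ.n∸n≡0 (suc n)))

σ*₃-via-convolution : ∀ n →
  σ*₃ (suc n) ≡ (toℚ (ℤ.+ 2) * toℚ (ℤ.+ suc n) - toℚ ℤ.1ℤ) * σ* (suc n) - toℚ (ℤ.+ 4) * toℚ (convolution n)
σ*₃-via-convolution n = begin
  toℚ s₃
    ≡⟨ cong toℚ s₃≡ ⟩
  toℚ (c ℤ.* s₁ ℤ.- ℤ.+ 4 ℤ.* convolution n)
    ≡⟨ toℚ-homo-- (c ℤ.* s₁) (ℤ.+ 4 ℤ.* convolution n) ⟩
  toℚ (c ℤ.* s₁) - toℚ (ℤ.+ 4 ℤ.* convolution n)
    ≡⟨ cong₂ _-_ (trans (toℚ-homo-* c s₁) (cong (_* toℚ s₁) c-homo)) (toℚ-homo-* (ℤ.+ 4) (convolution n)) ⟩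
  (toℚ (ℤ.+ 2) * toℚ (ℤ.+ suc n) - toℚ ℤ.1ℤ) * toℚ s₁ - toℚ (ℤ.+ 4) * toℚ (convolution n) ∎
  where
  open ≡-Reasoning
  s₁ s₃ c : ℤ.ℤ
  s₁ = σ*ℤ 1 (suc n)
  s₃ = σ*ℤ 3 (suc n)
  c = ℤ.+ 2 ℤ.* ℤ.+ suc n ℤ.- ℤ.1ℤ
  c-homo : toℚ c ≡ toℚ (ℤ.+ 2) * toℚ (ℤ.+ suc n) - toℚ ℤ.1ℤ
  c-homo = trans (toℚ-homo-- (ℤ.+ 2 ℤ.* ℤ.+ suc n) ℤ.1ℤ) (cong (_- toℚ ℤ.1ℤ) (toℚ-homo-* (ℤ.+ 2) (ℤ.+ suc n)))
  s₃≡ : s₃ ≡ c ℤ.* s₁ ℤ.- ℤ.+ 4 ℤ.* convolution n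
  s₃≡ = trans (isolate s₃ (c ℤ.* s₁)) (cong (ℤ._-_ (c ℤ.* s₁)) (sym (σ*ℤ-convolution n)))
    where
    isolate : ∀ a b → a ≡ b ℤ.- (b ℤ.- a)
    isolate = solve-∀

endpoint-identity : ∀ two N S four C h →
  (two * N - four * (h + h)) * S - four * C ≡ two * N * S - four * (h * S + C + S * h)
endpoint-identity = solve 6 (λ two N S four C h →
  (two :* N :- four :* (h :+ h)) :* S :- four :* C := two :* N :* S :- four :* (h :* S :+ C :+ S :* h)) refl
  where open +-*-Solver

theorem3p2 : (n : ℕ) →
    σ*₃ n ≡ ((+ 2) / 1) * ((+ n) / 1) * σ* n - ((+ 4) / 1) * Σ[0… n ] (λ j → σ* j * σ* (n ∸ j))
theorem3p2 zero    = refl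
theorem3p2 (suc n) = begin
  σ*₃ (suc n)
    ≡⟨ σ*₃-via-convolution n ⟩
  (two * N - toℚ ℤ.1ℤ) * S - four * C
    ≡⟨ cong (λ one → (two * N - one) * S - four * C) one≡4*[h+h] ⟩
  (two * N - four * (h + h)) * S - four * C
    ≡⟨ endpoint-identity two N S four C h ⟩
  two * N * S - four * (h * S + C + S * h)
    ≡⟨ cong (λ r → two * N * S - four * r) (Σ[0…]-σ*-convolution n) ⟨
  two * N * S - four * Σ[0… suc n ] (λ j → σ* j * σ* (suc n ∸ j)) ∎
  where
  open ≡-Reasoning
  two four N S C h : ℚ
  two = toℚ (ℤ.+ 2)
  four = toℚ (ℤ.+ 4)
  N = toℚ (ℤ.+ suc n)
  S = σ* (suc n)
  C = toℚ (convolution n)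
  h = σ* 0
  one≡4*[h+h] : toℚ ℤ.1ℤ ≡ four * (h + h)
  one≡4*[h+h] = refl
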